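{- The sub-operad $\mathcal{BW}$ of $\mathcal{BWTS}$ generated by the two trees (i) root labelled $\{1\}$ with one child labelled $\{2\}$, (ii) root labelled $\{2\}$ with one child labelled $\{1\}$, has as elements exactly the recursively labelled red and white trees with no empty nodes and no node carrying more than one label (equivalently, recursively labelled rooted trees with each node carrying exactly one label).
   Context: A red and white tree of weight $n$: rooted tree with unordered children, each node carrying a (possibly empty) set of labels, label sets disjoint with union $\{1,\dots,n\}$, empty nodes having at least two children; labelled nodes are white, an empty node is red iff all its children are white. It is recursively labelled if for every node the set of labels in its subtree is an interval of $\{1,\dots,n\}$. Composition $T_1\circ_xT_2$ ($T_2$ of weight $k$, $x$ a label of $T_1$ in node $z$): relabel $y>x$ in $T_1$ as $y+k-1$, add $x-1$ to labels of $T_2$; (W) root of $T_2$ not red: erase $x$ from $z$, add root labels of $T_2$ to $z$, make root's children children of $z$; (R1) root of $T_2$ red and $T_1$ the one-node tree $\{x\}$: result $T_2$; (R2) root of $T_2$ red and $z$ not a leaf or with at least two labels: remove $x$ from $z$, attach root of $T_2$ as child of $z$; (R3) root of $T_2$ red and $z$ a non-root leaf with sole label $x$: delete $z$, make children of root of $T_2$ children of the parent of $z$; $z$ is white if it ends without labels. $\mathcal{BWTS}$ is the set-operad (unit: one-node tree $\{1\}$) generated by the two trees above together with the one-node tree $\{1,2\}$ and the tree with red empty root and leaves $\{1\},\{2\}$. -}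

module Defs where

open import Data.Nat using (ℕ; zero; suc; _+_; _∸_; _≤_; _≡ᵇ_; _<ᵇ_)
open import Data.Bool using (Bool; true; false; if_then_else_; not; _∧_)
open import Data.List using (List; []; _∷_; _++_; map; length)
open import Data.Bool.ListAction using (any)
open import Data.List.Relation.Unary.All using (All)
open import Data.List.Relation.Unary.Unique.Propositional using (Unique)
open import Data.List.Membership.Propositional using (_∈_)
open import Data.List.Relation.Binary.Permutation.Propositional using (_↭_)
open import Data.Product using (_×_; ∃₂)
open import Function.Bundles using (_⇔_)
open import Relation.Binary.PropositionalEquality using (_≡_)

-- Raw rooted trees: a node carries a list of labels (a set, read up to
-- permutation) and a list of children (unordered, read up to permutation,
-- see _≈_ below).  The colour of a node is not stored: it is determined by
-- the definition (labelled ⇒ white; empty ⇒ red iff all children white).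

data Tree : Set where
  node : List ℕ → List Tree → Tree

rootLabels : Tree → List ℕ
rootLabels (node ls _) = ls

children : Tree → List Tree
children (node _ cs) = cs

mutual
  labelsOf : Tree → List ℕ
  labelsOf (node ls cs) = ls ++ labelsOfs cs

  labelsOfs : List Tree → List ℕ
  labelsOfs []       = []
  labelsOfs (c ∷ cs) = labelsOf c ++ labelsOfs cs

weight : Tree → ℕ
weight t = length (labelsOf t)

mutual
  isRed : Tree → Bool
  isRed (node []      cs) = allWhite cs
  isRed (node (_ ∷ _) _)  = false

  allWhite : List Tree → Bool
  allWhite []       = true
  allWhite (c ∷ cs) = not (isRed c) ∧ allWhite cs

data Every (P : Tree → Set) : Tree → Set where
  every : ∀ {ls cs} → P (node ls cs) → All (Every P) cs → Every P (node ls cs)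

IsRWTree : ℕ → Tree → Set
IsRWTree n t =
  Unique (labelsOf t)
  × (∀ y → (y ∈ labelsOf t) ⇔ (1 ≤ y × y ≤ n))
  × Every (λ s → rootLabels s ≡ [] → 2 ≤ length (children s)) t

mutual
  data _≈_ : Tree → Tree → Set where
    node≈ : ∀ {ls ls' cs cs'} → ls ↭ ls' → cs ≈ₗ cs' → node ls cs ≈ node ls' cs'

  data _≈ₗ_ : List Tree → List Tree → Set where
    nil   : [] ≈ₗ []
    cons  : ∀ {s t ss ts} → s ≈ t → ss ≈ₗ ts → (s ∷ ss) ≈ₗ (t ∷ ts)
    swap  : ∀ {s t ss} → (s ∷ t ∷ ss) ≈ₗ (t ∷ s ∷ ss)
    trans : ∀ {ss ts us} → ss ≈ₗ ts → ts ≈ₗ us → ss ≈ₗ us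

mutual
  mapLabels : (ℕ → ℕ) → Tree → Tree
  mapLabels f (node ls cs) = node (map f ls) (mapLabelss f cs)

  mapLabelss : (ℕ → ℕ) → List Tree → List Tree
  mapLabelss f []       = []
  mapLabelss f (c ∷ cs) = mapLabels f c ∷ mapLabelss f cs

elem : ℕ → List ℕ → Bool
elem x ls = any (λ y → y ≡ᵇ x) ls

remove : ℕ → List ℕ → List ℕ
remove x []       = []
remove x (y ∷ ls) = if y ≡ᵇ x then remove x ls else y ∷ remove x ls

isSoleLeaf : ℕ → Tree → Bool
isSoleLeaf x (node (y ∷ []) []) = y ≡ᵇ x
isSoleLeaf x _                  = false

module Insert (x : ℕ) (T₂ : Tree) where
  -- T₂ is the already shifted second tree
  red : Bool
  red = isRed T₂

  L₂ : List ℕ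
  L₂ = rootLabels T₂

  C₂ : List Tree
  C₂ = children T₂

  atZ : List ℕ → List Tree → Tree
  atZ ls cs = if red
              then node (remove x ls) (cs ++ (T₂ ∷ []))
              else node (remove x ls ++ L₂) (cs ++ C₂)

  mutual
    go : Tree → Tree
    go (node ls cs) = if elem x ls then atZ ls cs else node ls (goCs cs)

    goCs : List Tree → List Tree
    goCs []       = []
    goCs (c ∷ cs) = goChild c ++ goCs cs

    goChild : Tree → List Tree
    goChild c = if red ∧ isSoleLeaf x c then C₂ else (go c ∷ [])

_∘⟨_⟩_ : Tree → ℕ → Tree → Tree
T₁ ∘⟨ x ⟩ T₂ =
  if isRed T₂' ∧ isSoleLeaf x T₁'
  then T₂'
  else Insert.go x T₂' T₁'
  where
  k = weight T₂
  T₁' = mapLabels (λ y → if x <ᵇ y then y + k ∸ 1 else y) T₁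
  T₂' = mapLabels (λ y → y + (x ∸ 1)) T₂

-- Elements are isomorphism classes of trees, so the predicate is closed
-- under _≈_.

unitTree : Tree
unitTree = node (1 ∷ []) []

genI : Tree
genI = node (1 ∷ []) (node (2 ∷ []) [] ∷ [])

genII : Tree
genII = node (2 ∷ []) (node (1 ∷ []) [] ∷ [])

data InBW : Tree → Set where
  unit  : InBW unitTree
  gI    : InBW genI
  gII   : InBW genII
  comp  : ∀ {T₁ T₂} x → 1 ≤ x → x ≤ weight T₁ →
          InBW T₁ → InBW T₂ → InBW (T₁ ∘⟨ x ⟩ T₂)
  iso   : ∀ {T T'} → T ≈ T' → InBW T → InBW T'

IsInterval : List ℕ → Set
IsInterval S = ∃₂ λ a b → ∀ y → (y ∈ S) ⇔ (a ≤ y × y ≤ b)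

RecursivelyLabelled : Tree → Set
RecursivelyLabelled = Every (λ s → IsInterval (labelsOf s))

NoEmptyNode : Tree → Set
NoEmptyNode = Every (λ s → 1 ≤ length (rootLabels s))

AtMostOneLabel : Tree → Set
AtMostOneLabel = Every (λ s → length (rootLabels s) ≤ 1)

-- Both directions go through one invariant: every node carries exactly one label, and the labels
-- of every subtree form an interval, which is tracked through the multiplicity of each label.
-- Grafting a tree with labels x, …, x + k at the label x is, on labels, the identity outside that
-- block, and the block is the label set of the grafted subtree, so composition preserves the
-- invariant. Conversely, a tree with the invariant and at least two nodes has a node q whose leaf
-- child is labelled q + 1 or q − 1 (at an inner node all of whose children are leaves, one of these
-- lies in the interval of the node); deleting that leaf and closing the gap in the labels gives a
-- smaller such tree, and grafting generator (i) at q, or (ii) at q − 1, restores the original tree.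

module Submission where

open import Defs
open import Data.Bool using (Bool; true; false; if_then_else_; _∧_)
open import Data.Empty using (⊥-elim)
open import Data.List using (List; []; _∷_; _++_; map; length)
open import Data.List.Properties using (map-++; length-map; ++-assoc)
open import Data.List.Membership.Propositional using (_∈_)
open import Data.List.Relation.Unary.All using (All; []; _∷_)
import Data.List.Relation.Unary.All.Properties as All
open import Data.List.Relation.Unary.Any using (Any; here; there)
open import Data.List.Relation.Unary.AllPairs using (_∷_)
open import Data.List.Relation.Unary.Unique.Propositional using (Unique)
open import Data.List.Relation.Binary.Permutation.Propositional
  using (_↭_; refl; prep; swap; trans; ↭-sym; ↭-trans; ↭-reflexive)
open import Data.List.Relation.Binary.Permutation.Propositional.Properties using (++⁺; ++-comm; ↭-length)
open import Data.Nat using (ℕ; zero; suc; _+_; _∸_; _≤_; _<_; _≡ᵇ_; _<ᵇ_; _≤ᵇ_; z≤n; s≤s; s≤s⁻¹)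
open import Data.Nat.Properties
open import Algebra.Properties.CommutativeSemigroup +-commutativeSemigroup using (x∙yz≈y∙xz; interchange)
open import Data.Product using (_×_; _,_; Σ; proj₁; proj₂)
open import Data.Sum using (_⊎_; inj₁; inj₂; [_,_]′)
open import Function.Bundles using (_⇔_; mk⇔; Equivalence)
open import Relation.Nullary using (¬_; Dec; yes; no)
open import Relation.Nullary.Reflects using (Reflects; ofʸ; ofⁿ; fromEquivalence)
open import Relation.Binary.PropositionalEquality as ≡ using (_≡_; _≢_; ≢-sym; refl; sym; cong; cong₂; subst)

1≤n⇒m+n≤1⇒m≡0 : ∀ {m n} → 1 ≤ n → m + n ≤ 1 → m ≡ 0
1≤n⇒m+n≤1⇒m≡0 {zero}          _ _  = refl
1≤n⇒m+n≤1⇒m≡0 {suc m} {suc n} _ le = ⊥-elim (n≮0 (subst (_≤ 0) (+-suc m n) (s≤s⁻¹ le)))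

1≤m⇒m+n≤1⇒n≡0 : ∀ {m n} → 1 ≤ m → m + n ≤ 1 → n ≡ 0
1≤m⇒m+n≤1⇒n≡0 {m} {n} 1≤m le = 1≤n⇒m+n≤1⇒m≡0 1≤m (subst (_≤ 1) (+-comm m n) le)

m∸n≤o⇒m≤o+n : ∀ m n o → m ∸ n ≤ o → m ≤ o + n
m∸n≤o⇒m≤o+n m n o le = ≤-trans (m≤n+m∸n m n) (≤-trans (+-monoʳ-≤ n le) (≤-reflexive (+-comm n o)))

m≤o+n⇒m∸n≤o : ∀ m n o → m ≤ o + n → m ∸ n ≤ o
m≤o+n⇒m∸n≤o m n o le = m≤n+o⇒m∸n≤o m n (≤-trans le (≤-reflexive (+-comm o n)))

1+[m∸1]≡m : ∀ {m} → 1 ≤ m → suc (m ∸ 1) ≡ m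
1+[m∸1]≡m = m+[n∸m]≡n

m+2∸1≡1+m : ∀ m → m + 2 ∸ 1 ≡ suc m
m+2∸1≡1+m m = cong (_∸ 1) (+-comm m 2)

if-true : ∀ {A : Set} {g : Bool} {u v : A} → g ≡ true → (if g then u else v) ≡ u
if-true refl = refl

if-false : ∀ {A : Set} {g : Bool} {u v : A} → g ≡ false → (if g then u else v) ≡ v
if-false refl = refl

reflects-true : ∀ {P : Set} {g} → Reflects P g → P → g ≡ true
reflects-true (ofʸ _) _ = refl
reflects-true (ofⁿ ¬p) p = ⊥-elim (¬p p)

reflects-false : ∀ {P : Set} {g} → Reflects P g → ¬ P → g ≡ false
reflects-false (ofʸ p) ¬p = ⊥-elim (¬p p)
reflects-false (ofⁿ _) _ = refl

reflects-cong : ∀ {P Q : Set} {g h} → Reflects P g → Reflects Q h → (P → Q) → (Q → P) → g ≡ h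
reflects-cong (ofʸ _) (ofʸ _) _ _ = refl
reflects-cong (ofʸ p) (ofⁿ ¬q) f _ = ⊥-elim (¬q (f p))
reflects-cong (ofⁿ ¬p) (ofʸ q) _ g = ⊥-elim (¬p (g q))
reflects-cong (ofⁿ _) (ofⁿ _) _ _ = refl

≡ᵇ-reflects-≡ : ∀ m n → Reflects (m ≡ n) (m ≡ᵇ n)
≡ᵇ-reflects-≡ m n = fromEquivalence (≡ᵇ⇒≡ m n) (≡⇒≡ᵇ m n)

≡ᵇ-true : ∀ {m n} → m ≡ n → (m ≡ᵇ n) ≡ true
≡ᵇ-true = reflects-true (≡ᵇ-reflects-≡ _ _)

≡ᵇ-false : ∀ {m n} → m ≢ n → (m ≡ᵇ n) ≡ false
≡ᵇ-false = reflects-false (≡ᵇ-reflects-≡ _ _)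

<ᵇ-true : ∀ {m n} → m < n → (m <ᵇ n) ≡ true
<ᵇ-true = reflects-true (<ᵇ-reflects-< _ _)

<ᵇ-false : ∀ {m n} → n ≤ m → (m <ᵇ n) ≡ false
<ᵇ-false n≤m = reflects-false (<ᵇ-reflects-< _ _) (≤⇒≯ n≤m)

≤ᵇ-true : ∀ {m n} → m ≤ n → (m ≤ᵇ n) ≡ true
≤ᵇ-true = reflects-true (≤ᵇ-reflects-≤ _ _)

≤ᵇ-false : ∀ {m n} → n < m → (m ≤ᵇ n) ≡ false
≤ᵇ-false n<m = reflects-false (≤ᵇ-reflects-≤ _ _) (<⇒≱ n<m)

-- Multiplicities and intervals

δ : ℕ → ℕ → ℕ
δ y z = if y ≡ᵇ z then 1 else 0

δ-refl : ∀ y → δ y y ≡ 1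
δ-refl y = if-true (≡ᵇ-true {y} refl)

δ-≢ : ∀ {a b} → a ≢ b → δ a b ≡ 0
δ-≢ a≢b = if-false (≡ᵇ-false a≢b)

δ-cong : ∀ {a b c d} → (a ≡ b → c ≡ d) → (c ≡ d → a ≡ b) → δ a b ≡ δ c d
δ-cong f g = cong (λ t → if t then 1 else 0) (reflects-cong (≡ᵇ-reflects-≡ _ _) (≡ᵇ-reflects-≡ _ _) f g)

δ≡0⇒≢ : ∀ {a b} → δ a b ≡ 0 → a ≢ b
δ≡0⇒≢ {a} δ≡0 refl with () ← ≡.trans (sym (δ-refl a)) δ≡0

mult : ℕ → List ℕ → ℕ
mult z []      = 0
mult z (y ∷ L) = δ y z + mult z L

mult-++ : ∀ z A B → mult z (A ++ B) ≡ mult z A + mult z B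
mult-++ z []      B = refl
mult-++ z (y ∷ A) B = ≡.trans (cong (δ y z +_) (mult-++ z A B)) (sym (+-assoc (δ y z) _ _))

mult-↭ : ∀ z {A B} → A ↭ B → mult z A ≡ mult z B
mult-↭ z refl          = refl
mult-↭ z (prep y p)    = cong (δ y z +_) (mult-↭ z p)
mult-↭ z (swap x y p)  = ≡.trans (cong (λ u → δ x z + (δ y z + u)) (mult-↭ z p)) (x∙yz≈y∙xz (δ x z) (δ y z) _)
mult-↭ z (trans p q)   = ≡.trans (mult-↭ z p) (mult-↭ z q)

mult-map : ∀ f e z w → (∀ y → y ≢ e → δ (f y) z ≡ δ y w) →
           ∀ L → mult e L ≡ 0 → mult z (map f L) ≡ mult w L
mult-map f e z w fδ []      _  = refl
mult-map f e z w fδ (y ∷ L) e∉ =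
  cong₂ _+_ (fδ y (δ≡0⇒≢ (m+n≡0⇒m≡0 (δ y e) e∉))) (mult-map f e z w fδ L (m+n≡0⇒n≡0 (δ y e) e∉))

∈⇒mult≥1 : ∀ {y L} → y ∈ L → 1 ≤ mult y L
∈⇒mult≥1 {y} (here refl) rewrite δ-refl y = s≤s z≤n
∈⇒mult≥1 {y} {z ∷ L} (there y∈L) = ≤-trans (∈⇒mult≥1 y∈L) (m≤n+m (mult y L) (δ z y))

mult≥1⇒∈ : ∀ {y} L → 1 ≤ mult y L → y ∈ L
mult≥1⇒∈ {y} (z ∷ L) p with z ≟ y
... | yes refl = here refl
... | no z≢y rewrite δ-≢ z≢y = there (mult≥1⇒∈ L p)

∉⇒mult≡0 : ∀ {y} L → ¬ (y ∈ L) → mult y L ≡ 0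
∉⇒mult≡0 {y} L y∉L with mult y L in eq
... | zero  = refl
... | suc _ = ⊥-elim (y∉L (mult≥1⇒∈ L (subst (1 ≤_) (sym eq) (s≤s z≤n))))

Unique⇒mult≤1 : ∀ L → Unique L → ∀ z → mult z L ≤ 1
Unique⇒mult≤1 []      _            z = z≤n
Unique⇒mult≤1 (y ∷ L) (y∉ ∷ uniq) z with y ≟ z
... | yes refl rewrite δ-refl y | ∉⇒mult≡0 L (All.All¬⇒¬Any y∉) = ≤-refl
... | no y≢z  rewrite δ-≢ y≢z = Unique⇒mult≤1 L uniq z

χ : ℕ → ℕ → ℕ → ℕ
χ a b z = if (a ≤ᵇ z) ∧ (z ≤ᵇ b) then 1 else 0

χ-inside : ∀ {a b z} → a ≤ z → z ≤ b → χ a b z ≡ 1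
χ-inside a≤z z≤b rewrite ≤ᵇ-true a≤z | ≤ᵇ-true z≤b = refl

χ-below : ∀ {a b z} → z < a → χ a b z ≡ 0
χ-below z<a rewrite ≤ᵇ-false z<a = refl

χ-above : ∀ {a b z} → b < z → χ a b z ≡ 0
χ-above {a} {b} {z} b<z rewrite ≤ᵇ-false b<z with a ≤ᵇ z
... | true  = refl
... | false = refl

χ≤1 : ∀ a b z → χ a b z ≤ 1
χ≤1 a b z with (a ≤ᵇ z) ∧ (z ≤ᵇ b)
... | true  = ≤-refl
... | false = z≤n

χ≥1⇒inside : ∀ {a b z} → 1 ≤ χ a b z → a ≤ z × z ≤ b
χ≥1⇒inside {a} {b} {z} p with a ≤? z | z ≤? b
... | yes a≤z | yes z≤b = a≤z , z≤b
... | no a≰z  | _       rewrite χ-below {a} {b} (≰⇒> a≰z) with () ← p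
... | yes _   | no z≰b  rewrite χ-above {a} {b} (≰⇒> z≰b) with () ← p

χ-cong : ∀ {a b u a' b' v} → (a ≤ u → a' ≤ v) → (a' ≤ v → a ≤ u) →
         (u ≤ b → v ≤ b') → (v ≤ b' → u ≤ b) → χ a b u ≡ χ a' b' v
χ-cong f f' g g' = cong (λ t → if t then 1 else 0)
  (cong₂ _∧_ (reflects-cong (≤ᵇ-reflects-≤ _ _) (≤ᵇ-reflects-≤ _ _) f f')
             (reflects-cong (≤ᵇ-reflects-≤ _ _) (≤ᵇ-reflects-≤ _ _) g g'))

Enumerates : ℕ → ℕ → List ℕ → Set
Enumerates a b L = ∀ z → mult z L ≡ χ a b z

Enumerates-↭ : ∀ {a b A B} → A ↭ B → Enumerates a b A → Enumerates a b B
Enumerates-↭ A↭B enum z = ≡.trans (sym (mult-↭ z A↭B)) (enum z)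

Enumerates⇒mult≤1 : ∀ {a b} L z → Enumerates a b L → mult z L ≤ 1
Enumerates⇒mult≤1 {a} {b} L z enum = ≤-trans (≤-reflexive (enum z)) (χ≤1 a b z)

Enumerates⇒IsInterval : ∀ {a b} L → Enumerates a b L → IsInterval L
Enumerates⇒IsInterval {a} {b} L enum = a , b , λ y → mk⇔
  (λ y∈L → χ≥1⇒inside (≤-trans (∈⇒mult≥1 y∈L) (≤-reflexive (enum y))))
  (λ (a≤y , y≤b) → mult≥1⇒∈ L (≤-reflexive (sym (≡.trans (enum y) (χ-inside a≤y y≤b)))))

IsInterval⇒Enumerates : ∀ {a b} L → (∀ z → mult z L ≤ 1) → (∀ y → (y ∈ L) ⇔ (a ≤ y × y ≤ b)) → Enumerates a b L
IsInterval⇒Enumerates {a} {b} L mult≤1 iff z with a ≤? z | z ≤? b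
... | yes a≤z | yes z≤b = ≡.trans (≤-antisym (mult≤1 z) (∈⇒mult≥1 (Equivalence.from (iff z) (a≤z , z≤b))))
                                  (sym (χ-inside a≤z z≤b))
... | no a≰z  | _       = ≡.trans (∉⇒mult≡0 L (λ z∈L → a≰z (proj₁ (Equivalence.to (iff z) z∈L))))
                                  (sym (χ-below {a} {b} (≰⇒> a≰z)))
... | yes _   | no z≰b  = ≡.trans (∉⇒mult≡0 L (λ z∈L → z≰b (proj₂ (Equivalence.to (iff z) z∈L))))
                                  (sym (χ-above {a} {b} (≰⇒> z≰b)))

sumBelow : ℕ → (ℕ → ℕ) → ℕ
sumBelow zero    h = 0
sumBelow (suc N) h = sumBelow N h + h N

sumBelow-cong : ∀ N {h h'} → (∀ z → z < N → h z ≡ h' z) → sumBelow N h ≡ sumBelow N h'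
sumBelow-cong zero    eq = refl
sumBelow-cong (suc N) eq = cong₂ _+_ (sumBelow-cong N (λ z z<N → eq z (m<n⇒m<1+n z<N))) (eq N ≤-refl)

sumBelow-+ : ∀ N h h' → sumBelow N (λ z → h z + h' z) ≡ sumBelow N h + sumBelow N h'
sumBelow-+ zero    h h' = refl
sumBelow-+ (suc N) h h' rewrite sumBelow-+ N h h' = interchange (sumBelow N h) (sumBelow N h') (h N) (h' N)

sumBelow-δ-≥ : ∀ N y → N ≤ y → sumBelow N (δ y) ≡ 0
sumBelow-δ-≥ zero    y _   = refl
sumBelow-δ-≥ (suc N) y N<y rewrite sumBelow-δ-≥ N y (<⇒≤ N<y) = δ-≢ (λ y≡N → <-irrefl (sym y≡N) N<y)

sumBelow-δ-< : ∀ N y → y < N → sumBelow N (δ y) ≡ 1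
sumBelow-δ-< (suc N) y y<1+N with m≤n⇒m<n∨m≡n (s≤s⁻¹ y<1+N)
... | inj₁ y<N  rewrite sumBelow-δ-< N y y<N = cong (1 +_) (δ-≢ (λ y≡N → <-irrefl y≡N y<N))
... | inj₂ refl rewrite sumBelow-δ-≥ N N ≤-refl = δ-refl N

sumBelow-0 : ∀ N → sumBelow N (λ _ → 0) ≡ 0
sumBelow-0 zero    = refl
sumBelow-0 (suc N) = cong (_+ 0) (sumBelow-0 N)

sumBelow-mult : ∀ N L → (∀ y → N ≤ y → mult y L ≡ 0) → sumBelow N (λ z → mult z L) ≡ length L
sumBelow-mult N []      _     = sumBelow-0 N
sumBelow-mult N (y ∷ L) small = ≡.trans (sumBelow-+ N (δ y) (λ z → mult z L))
  (cong₂ _+_ (sumBelow-δ-< N y y<N) (sumBelow-mult N L (λ y' N≤y' → m+n≡0⇒n≡0 (δ y y') (small y' N≤y'))))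
  where
  y<N : y < N
  y<N with y <? N
  ... | yes y<N = y<N
  ... | no y≮N with () ← ≡.trans (cong (_+ mult y L) (sym (δ-refl y))) (small y (≮⇒≥ y≮N))

sumBelow-χ : ∀ b → sumBelow (suc b) (χ 1 b) ≡ b
sumBelow-χ zero    = refl
sumBelow-χ (suc b) = ≡.trans
  (cong₂ _+_ (≡.trans (sumBelow-cong (suc b) (λ z z<1+b →
                         χ-cong (λ p → p) (λ p → p) (λ _ → s≤s⁻¹ z<1+b) (λ _ → m≤n⇒m≤1+n (s≤s⁻¹ z<1+b))))
                      (sumBelow-χ b))
             (χ-inside {1} {suc b} (s≤s z≤n) ≤-refl))
  (+-comm b 1)

Enumerates⇒length : ∀ {b} L → Enumerates 1 b L → length L ≡ b
Enumerates⇒length {b} L enum =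
  ≡.trans (sym (sumBelow-mult (suc b) L (λ y b<y → ≡.trans (enum y) (χ-above {1} {b} b<y))))
          (≡.trans (sumBelow-cong (suc b) (λ z _ → enum z)) (sumBelow-χ b))

mutual
  labelsOf-mapLabels : ∀ f t → labelsOf (mapLabels f t) ≡ map f (labelsOf t)
  labelsOf-mapLabels f (node ls cs) =
    ≡.trans (cong (map f ls ++_) (labelsOfs-mapLabelss f cs)) (sym (map-++ f ls (labelsOfs cs)))

  labelsOfs-mapLabelss : ∀ f cs → labelsOfs (mapLabelss f cs) ≡ map f (labelsOfs cs)
  labelsOfs-mapLabelss f []       = refl
  labelsOfs-mapLabelss f (c ∷ cs) =
    ≡.trans (cong₂ _++_ (labelsOf-mapLabels f c) (labelsOfs-mapLabelss f cs))
            (sym (map-++ f (labelsOf c) (labelsOfs cs)))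

labelsOfs-++ : ∀ A B → labelsOfs (A ++ B) ≡ labelsOfs A ++ labelsOfs B
labelsOfs-++ []      B = refl
labelsOfs-++ (c ∷ A) B = ≡.trans (cong (labelsOf c ++_) (labelsOfs-++ A B)) (sym (++-assoc (labelsOf c) _ _))

mult-node : ∀ z ls cs → mult z (labelsOf (node ls cs)) ≡ mult z ls + mult z (labelsOfs cs)
mult-node z ls cs = mult-++ z ls (labelsOfs cs)

mult-cons : ∀ z c cs → mult z (labelsOfs (c ∷ cs)) ≡ mult z (labelsOf c) + mult z (labelsOfs cs)
mult-cons z c cs = mult-++ z (labelsOf c) (labelsOfs cs)

mult-node≡0 : ∀ z ls cs → mult z (labelsOf (node ls cs)) ≡ 0 → mult z ls ≡ 0 × mult z (labelsOfs cs) ≡ 0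
mult-node≡0 z ls cs z∉ = let z∉' = ≡.trans (sym (mult-node z ls cs)) z∉ in m+n≡0⇒m≡0 _ z∉' , m+n≡0⇒n≡0 _ z∉'

mult-cons≡0 : ∀ z c cs → mult z (labelsOfs (c ∷ cs)) ≡ 0 → mult z (labelsOf c) ≡ 0 × mult z (labelsOfs cs) ≡ 0
mult-cons≡0 z c cs z∉ = let z∉' = ≡.trans (sym (mult-cons z c cs)) z∉ in m+n≡0⇒m≡0 _ z∉' , m+n≡0⇒n≡0 _ z∉'

mutual
  ≈⇒labels↭ : ∀ {s t} → s ≈ t → labelsOf s ↭ labelsOf t
  ≈⇒labels↭ (node≈ ls↭ cs≈) = ++⁺ ls↭ (≈ₗ⇒labels↭ cs≈)

  ≈ₗ⇒labels↭ : ∀ {ss ts} → ss ≈ₗ ts → labelsOfs ss ↭ labelsOfs ts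
  ≈ₗ⇒labels↭ nil            = refl
  ≈ₗ⇒labels↭ (cons s≈ ss≈)  = ++⁺ (≈⇒labels↭ s≈) (≈ₗ⇒labels↭ ss≈)
  ≈ₗ⇒labels↭ (swap {s} {t} {ss}) =
    ↭-trans (↭-sym (↭-reflexive (++-assoc (labelsOf s) (labelsOf t) (labelsOfs ss))))
      (↭-trans (++⁺ (++-comm (labelsOf s) (labelsOf t)) refl)
               (↭-reflexive (++-assoc (labelsOf t) (labelsOf s) (labelsOfs ss))))
  ≈ₗ⇒labels↭ (trans p q)    = ↭-trans (≈ₗ⇒labels↭ p) (≈ₗ⇒labels↭ q)

mutual
  ≈-refl : ∀ {s} → s ≈ s
  ≈-refl {node ls cs} = node≈ refl ≈ₗ-refl

  ≈ₗ-refl : ∀ {ss} → ss ≈ₗ ss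
  ≈ₗ-refl {[]}     = nil
  ≈ₗ-refl {s ∷ ss} = cons ≈-refl ≈ₗ-refl

≈ₗ-rotate : ∀ (t : Tree) ts → (ts ++ t ∷ []) ≈ₗ (t ∷ ts)
≈ₗ-rotate t []       = ≈ₗ-refl
≈ₗ-rotate t (s ∷ ts) = trans (cons ≈-refl (≈ₗ-rotate t ts)) swap

module _ {P Q : Tree → Set} where
  mutual
    Every-map : (∀ {s} → P s → Q s) → ∀ {t} → Every P t → Every Q t
    Every-map f (every p ps) = every (f p) (All-Every-map f ps)

    All-Every-map : (∀ {s} → P s → Q s) → ∀ {ts} → All (Every P) ts → All (Every Q) ts
    All-Every-map f []       = []
    All-Every-map f (p ∷ ps) = Every-map f p ∷ All-Every-map f ps

  mutual
    Every-mapLabels : ∀ g → (∀ {s} → P s → Q (mapLabels g s)) → ∀ {t} → Every P t → Every Q (mapLabels g t)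
    Every-mapLabels g f (every p ps) = every (f p) (All-Every-mapLabels g f ps)

    All-Every-mapLabels : ∀ g → (∀ {s} → P s → Q (mapLabels g s)) →
                          ∀ {ts} → All (Every P) ts → All (Every Q) (mapLabelss g ts)
    All-Every-mapLabels g f []       = []
    All-Every-mapLabels g f (p ∷ ps) = Every-mapLabels g f p ∷ All-Every-mapLabels g f ps

  module _ {R : Tree → Set} where
    mutual
      Every-zipWith : (∀ {s} → P s → Q s → R s) → ∀ {t} → Every P t → Every Q t → Every R t
      Every-zipWith f (every p ps) (every q qs) = every (f p q) (All-Every-zipWith f ps qs)

      All-Every-zipWith : (∀ {s} → P s → Q s → R s) →
                          ∀ {ts} → All (Every P) ts → All (Every Q) ts → All (Every R) ts
      All-Every-zipWith f []       []       = []
      All-Every-zipWith f (p ∷ ps) (q ∷ qs) = Every-zipWith f p q ∷ All-Every-zipWith f ps qs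

module _ {P : Tree → Set} (P-≈ : ∀ {s t} → s ≈ t → P s → P t) where
  mutual
    Every-≈ : ∀ {s t} → s ≈ t → Every P s → Every P t
    Every-≈ s≈t@(node≈ _ cs≈) (every p ps) = every (P-≈ s≈t p) (All-Every-≈ cs≈ ps)

    All-Every-≈ : ∀ {ss ts} → ss ≈ₗ ts → All (Every P) ss → All (Every P) ts
    All-Every-≈ nil          []           = []
    All-Every-≈ (cons p q)   (e ∷ es)     = Every-≈ p e ∷ All-Every-≈ q es
    All-Every-≈ swap         (e ∷ f ∷ es) = f ∷ e ∷ es
    All-Every-≈ (trans p q)  es           = All-Every-≈ q (All-Every-≈ p es)

module _ (K : ℕ → ℕ) where
  mutual
    Every-mult≤ : ∀ t → (∀ z → mult z (labelsOf t) ≤ K z) → Every (λ s → ∀ z → mult z (labelsOf s) ≤ K z) t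
    Every-mult≤ (node ls cs) bound =
      every bound (All-Every-mult≤ cs (λ z → ≤-trans (m≤n+m _ (mult z ls)) (subst (_≤ K z) (mult-node z ls cs) (bound z))))

    All-Every-mult≤ : ∀ cs → (∀ z → mult z (labelsOfs cs) ≤ K z) →
                      All (Every (λ s → ∀ z → mult z (labelsOf s) ≤ K z)) cs
    All-Every-mult≤ []       bound = []
    All-Every-mult≤ (c ∷ cs) bound =
      Every-mult≤ c (λ z → ≤-trans (m≤m+n _ _) (subst (_≤ K z) (mult-cons z c cs) (bound z)))
      ∷ All-Every-mult≤ cs (λ z → ≤-trans (m≤n+m _ _) (subst (_≤ K z) (mult-cons z c cs) (bound z)))

SingleLabel : Tree → Set
SingleLabel s = length (rootLabels s) ≡ 1

IntervalLabels : Tree → Set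
IntervalLabels s = Σ ℕ λ a → Σ ℕ λ b → 1 ≤ a × Enumerates a b (labelsOf s)

-- The invariant characterising the trees of BW.
WellLabelled : ℕ → Tree → Set
WellLabelled n T = Every SingleLabel T × Every IntervalLabels T × Enumerates 1 n (labelsOf T)

SingleLabel-≈ : ∀ {s t} → s ≈ t → SingleLabel s → SingleLabel t
SingleLabel-≈ (node≈ ls↭ _) one = ≡.trans (sym (↭-length ls↭)) one

SingleLabel-mapLabels : ∀ g {s} → SingleLabel s → SingleLabel (mapLabels g s)
SingleLabel-mapLabels g {node ls _} single = ≡.trans (length-map g ls) single

IntervalLabels-≈ : ∀ {s t} → s ≈ t → IntervalLabels s → IntervalLabels t
IntervalLabels-≈ s≈t (a , b , 1≤a , enum) = a , b , 1≤a , Enumerates-↭ {a} {b} (≈⇒labels↭ s≈t) enum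

WellLabelled-≈ : ∀ {n s t} → s ≈ t → WellLabelled n s → WellLabelled n t
WellLabelled-≈ {n} s≈t (single , interval , enum) =
  Every-≈ SingleLabel-≈ s≈t single ,
  Every-≈ IntervalLabels-≈ s≈t interval ,
  Enumerates-↭ {1} {n} (≈⇒labels↭ s≈t) enum

-- Composition preserves the invariant

-- Grafting a tree of weight 1 + k at the label x turns the labels x, …, x + k of the result into the
-- single label x of the host tree; φ is this collapse on labels.
module Collapse (x k : ℕ) where

  φ : ℕ → ℕ
  φ z = if z <ᵇ x then z else (if x + k <ᵇ z then z ∸ k else x)

  data Region (z : ℕ) : Set where
    below  : z < x → Region z
    inside : x ≤ z → z ≤ x + k → Region z
    above  : x + k < z → Region z

  region : ∀ z → Region z
  region z with z <? x
  ... | yes z<x = below z<x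
  ... | no z≮x with x + k <? z
  ... | yes x+k<z = above x+k<z
  ... | no x+k≮z  = inside (≮⇒≥ z≮x) (≮⇒≥ x+k≮z)

  φ-below : ∀ {z} → z < x → φ z ≡ z
  φ-below z<x = if-true (<ᵇ-true z<x)

  φ-inside : ∀ {z} → x ≤ z → z ≤ x + k → φ z ≡ x
  φ-inside {z} x≤z z≤x+k rewrite <ᵇ-false {z} x≤z | <ᵇ-false {x + k} z≤x+k = refl

  φ-above : ∀ {z} → x + k < z → φ z ≡ z ∸ k
  φ-above {z} x+k<z rewrite <ᵇ-false {z} (≤-trans (m≤m+n x k) (<⇒≤ x+k<z)) | <ᵇ-true x+k<z = refl

  above⇒x<z∸k : ∀ {z} → x + k < z → x < z ∸ k
  above⇒x<z∸k {z} = m+n≤o⇒m≤o∸n (suc x)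

  above⇒k≤z : ∀ {z} → x + k < z → k ≤ z
  above⇒k≤z x+k<z = ≤-trans (m≤n+m k x) (<⇒≤ x+k<z)

  above⇒x≤z : ∀ {z} → x + k < z → x ≤ z
  above⇒x≤z x+k<z = ≤-trans (m≤m+n x k) (<⇒≤ x+k<z)

  δ-x-φ : ∀ z → δ x (φ z) ≡ χ x (x + k) z
  δ-x-φ z with region z
  ... | below z<x rewrite φ-below z<x =
    ≡.trans (δ-≢ (λ x≡z → <-irrefl (sym x≡z) z<x)) (sym (χ-below z<x))
  ... | inside x≤z z≤x+k rewrite φ-inside x≤z z≤x+k = ≡.trans (δ-refl x) (sym (χ-inside x≤z z≤x+k))
  ... | above x+k<z rewrite φ-above x+k<z =
    ≡.trans (δ-≢ (λ x≡ → <-irrefl x≡ (above⇒x<z∸k x+k<z))) (sym (χ-above {x} {x + k} x+k<z))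

  -- Galois adjoints of φ: a ≤ φ z ⇔ lower a ≤ z and φ z ≤ b ⇔ z ≤ upper b.
  lower : ℕ → ℕ
  lower a = if a ≤ᵇ x then a else a + k

  upper : ℕ → ℕ
  upper b = if x ≤ᵇ b then b + k else b

  lower-adjoint : ∀ a z → (a ≤ φ z → lower a ≤ z) × (lower a ≤ z → a ≤ φ z)
  lower-adjoint a z with a ≤? x
  ... | yes a≤x rewrite if-true {u = a} {v = a + k} (≤ᵇ-true a≤x) = to , from
    where
    to : a ≤ φ z → a ≤ z
    to a≤φz with region z
    ... | below z<x rewrite φ-below z<x = a≤φz
    ... | inside x≤z _ = ≤-trans a≤x x≤z
    ... | above x+k<z = ≤-trans a≤x (above⇒x≤z x+k<z)
    from : a ≤ z → a ≤ φ z
    from a≤z with region z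
    ... | below z<x rewrite φ-below z<x = a≤z
    ... | inside x≤z z≤x+k rewrite φ-inside x≤z z≤x+k = a≤x
    ... | above x+k<z rewrite φ-above x+k<z = ≤-trans a≤x (<⇒≤ (above⇒x<z∸k x+k<z))
  ... | no a≰x rewrite if-false {u = a} {v = a + k} (≤ᵇ-false (≰⇒> a≰x)) = to , from
    where
    x<a = ≰⇒> a≰x
    to : a ≤ φ z → a + k ≤ z
    to a≤φz with region z
    ... | below z<x rewrite φ-below z<x = ⊥-elim (<⇒≱ (<-trans z<x x<a) a≤φz)
    ... | inside x≤z z≤x+k rewrite φ-inside x≤z z≤x+k = ⊥-elim (<⇒≱ x<a a≤φz)
    ... | above x+k<z rewrite φ-above x+k<z = m≤o∸n⇒m+n≤o a (above⇒k≤z x+k<z) a≤φz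
    from : a + k ≤ z → a ≤ φ z
    from a+k≤z with region z
    ... | below z<x = ⊥-elim (<⇒≱ (<-trans z<x x<a) (≤-trans (m≤m+n a k) a+k≤z))
    ... | inside _ z≤x+k = ⊥-elim (<⇒≱ (+-monoˡ-< k x<a) (≤-trans a+k≤z z≤x+k))
    ... | above x+k<z rewrite φ-above x+k<z = m+n≤o⇒m≤o∸n a a+k≤z

  upper-adjoint : ∀ b z → (φ z ≤ b → z ≤ upper b) × (z ≤ upper b → φ z ≤ b)
  upper-adjoint b z with x ≤? b
  ... | yes x≤b rewrite if-true {u = b + k} {v = b} (≤ᵇ-true x≤b) = to , from
    where
    to : φ z ≤ b → z ≤ b + k
    to φz≤b with region z
    ... | below z<x rewrite φ-below z<x = m≤n⇒m≤n+o k φz≤b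
    ... | inside _ z≤x+k = ≤-trans z≤x+k (+-monoˡ-≤ k x≤b)
    ... | above x+k<z rewrite φ-above x+k<z = m∸n≤o⇒m≤o+n z k b φz≤b
    from : z ≤ b + k → φ z ≤ b
    from z≤b+k with region z
    ... | below z<x rewrite φ-below z<x = ≤-trans (<⇒≤ z<x) x≤b
    ... | inside x≤z z≤x+k rewrite φ-inside x≤z z≤x+k = x≤b
    ... | above x+k<z rewrite φ-above x+k<z = m≤o+n⇒m∸n≤o z k b z≤b+k
  ... | no x≰b rewrite if-false {u = b + k} {v = b} (≤ᵇ-false (≰⇒> x≰b)) = to , from
    where
    b<x = ≰⇒> x≰b
    to : φ z ≤ b → z ≤ b
    to φz≤b with region z
    ... | below z<x rewrite φ-below z<x = φz≤b
    ... | inside x≤z z≤x+k rewrite φ-inside x≤z z≤x+k = ⊥-elim (<⇒≱ b<x φz≤b)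
    ... | above x+k<z rewrite φ-above x+k<z = ⊥-elim (<⇒≱ (<-trans b<x (above⇒x<z∸k x+k<z)) φz≤b)
    from : z ≤ b → φ z ≤ b
    from z≤b with region z
    ... | below z<x rewrite φ-below z<x = z≤b
    ... | inside x≤z _ = ⊥-elim (<⇒≱ b<x (≤-trans x≤z z≤b))
    ... | above x+k<z = ⊥-elim (<⇒≱ (<-≤-trans b<x (above⇒x≤z x+k<z)) z≤b)

  χ-φ : ∀ a b z → χ a b (φ z) ≡ χ (lower a) (upper b) z
  χ-φ a b z = χ-cong (proj₁ (lower-adjoint a z)) (proj₂ (lower-adjoint a z))
                     (proj₁ (upper-adjoint b z)) (proj₂ (upper-adjoint b z))

  lower-≥ : ∀ a → a ≤ lower a
  lower-≥ a with a ≤ᵇ x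
  ... | true  = ≤-refl
  ... | false = m≤m+n a k

  lower-≤x : ∀ {a} → a ≤ x → lower a ≡ a
  lower-≤x a≤x = if-true (≤ᵇ-true a≤x)

  upper-≥x : ∀ {b} → x ≤ b → upper b ≡ b + k
  upper-≥x x≤b = if-true (≤ᵇ-true x≤b)

  module _ (f : ℕ → ℕ) (f-≤ : ∀ y → y ≤ x → f y ≡ y) (f-> : ∀ y → x < y → f y ≡ y + k) where

    δ-f-φ : ∀ y z → y ≢ x → δ (f y) z ≡ δ y (φ z)
    δ-f-φ y z y≢x = δ-cong to from
      where
      to : f y ≡ z → y ≡ φ z
      to fy≡z with y <? x
      ... | yes y<x rewrite f-≤ y (<⇒≤ y<x) = ≡.trans fy≡z (sym (φ-below (subst (_< x) fy≡z y<x)))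
      ... | no y≮x =
        ≡.trans (sym (m+n∸n≡m y k))
                (≡.trans (cong (_∸ k) y+k≡z) (sym (φ-above (subst (x + k <_) y+k≡z (+-monoˡ-< k x<y)))))
        where
        x<y = ≤∧≢⇒< (≮⇒≥ y≮x) (λ x≡y → y≢x (sym x≡y))
        y+k≡z = ≡.trans (sym (f-> y x<y)) fy≡z
      from : y ≡ φ z → f y ≡ z
      from y≡φz with region z
      ... | below z<x rewrite φ-below z<x | y≡φz = f-≤ z (<⇒≤ z<x)
      ... | inside x≤z z≤x+k rewrite φ-inside x≤z z≤x+k = ⊥-elim (y≢x y≡φz)
      ... | above x+k<z rewrite φ-above x+k<z | y≡φz =
        ≡.trans (f-> (z ∸ k) (above⇒x<z∸k x+k<z)) (m∸n+n≡m (above⇒k≤z x+k<z))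

    mult-map-φ : ∀ L → mult x L ≡ 0 → ∀ z → mult z (map f L) ≡ mult (φ z) L
    mult-map-φ L x∉L z = mult-map f x z (φ z) (λ y y≢x → δ-f-φ y z y≢x) L x∉L

    mult-x-map : ∀ L → mult x L ≡ 0 → mult x (map f L) ≡ 0
    mult-x-map L x∉L =
      ≡.trans (mult-map-φ L x∉L x) (subst (λ w → mult w L ≡ 0) (sym (φ-inside ≤-refl (m≤m+n x k))) x∉L)

elem-false : ∀ x ls → mult x ls ≡ 0 → elem x ls ≡ false
elem-false x []       _    = refl
elem-false x (y ∷ ls) x∉ rewrite ≡ᵇ-false (δ≡0⇒≢ {y} {x} (m+n≡0⇒m≡0 (δ y x) x∉)) =
  elem-false x ls (m+n≡0⇒n≡0 (δ y x) x∉)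

-- Insertion of a tree whose root carries a single label, hence is white: only rule (W) applies.
module InsertAt (x r : ℕ) (C₂ : List Tree) where
  open Insert x (node (r ∷ []) C₂) public using (go; goCs; atZ)

  go-∌ : ∀ ls cs → elem x ls ≡ false → go (node ls cs) ≡ node ls (goCs cs)
  go-∌ ls cs e = cong (λ t → if t then atZ ls cs else node ls (goCs cs)) e

  go-x : ∀ cs → go (node (x ∷ []) cs) ≡ node (r ∷ []) (cs ++ C₂)
  go-x cs rewrite ≡ᵇ-true {x} refl = refl

  mutual
    go-∌x : ∀ t → mult x (labelsOf t) ≡ 0 → go t ≡ t
    go-∌x (node ls cs) x∉ =
      let (x∉ls , x∉cs) = mult-node≡0 x ls cs x∉ in
      ≡.trans (go-∌ ls cs (elem-false x ls x∉ls)) (cong (node ls) (goCs-∌x cs x∉cs))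

    goCs-∌x : ∀ cs → mult x (labelsOfs cs) ≡ 0 → goCs cs ≡ cs
    goCs-∌x []       _  = refl
    goCs-∌x (c ∷ cs) x∉ =
      let (x∉c , x∉cs) = mult-cons≡0 x c cs x∉ in
      cong₂ _∷_ (go-∌x c x∉c) (goCs-∌x cs x∉cs)

module Graft (x k : ℕ) (f : ℕ → ℕ) (f-≤ : ∀ y → y ≤ x → f y ≡ y) (f-> : ∀ y → x < y → f y ≡ y + k)
  (r : ℕ) (C₂ : List Tree) (T₂-enum : Enumerates x (x + k) (labelsOf (node (r ∷ []) C₂)))
  (C₂-single : All (Every SingleLabel) C₂) (C₂-interval : All (Every IntervalLabels) C₂) where

  open Collapse x k
  open InsertAt x r C₂

  graft : Tree → Tree
  graft t = go (mapLabels f t)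

  graft-x : ∀ cs → graft (node (x ∷ []) cs) ≡ node (r ∷ []) (mapLabelss f cs ++ C₂)
  graft-x cs = ≡.trans (cong (λ y → go (node (y ∷ []) (mapLabelss f cs))) (f-≤ x ≤-refl)) (go-x _)

  graft-≢ : ∀ y cs → y ≢ x → graft (node (y ∷ []) cs) ≡ node (f y ∷ []) (goCs (mapLabelss f cs))
  graft-≢ y cs y≢x = go-∌ _ _ (elem-false x (f y ∷ []) (mult-x-map f f-≤ f-> (y ∷ []) (cong (_+ 0) (δ-≢ y≢x))))

  mapLabelss-∌x : ∀ cs → mult x (labelsOfs cs) ≡ 0 → goCs (mapLabelss f cs) ≡ mapLabelss f cs
  mapLabelss-∌x cs x∉ =
    goCs-∌x _ (≡.trans (cong (mult x) (labelsOfs-mapLabelss f cs)) (mult-x-map f f-≤ f-> (labelsOfs cs) x∉))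

  x∉children : ∀ L → mult x (x ∷ L) ≤ 1 → mult x L ≡ 0
  x∉children L bound rewrite δ-refl x = n≤0⇒n≡0 (s≤s⁻¹ bound)

  mutual
    mult-graft : ∀ t → Every SingleLabel t → mult x (labelsOf t) ≤ 1 →
                 ∀ z → mult z (labelsOf (graft t)) ≡ mult (φ z) (labelsOf t)
    mult-graft (node (y ∷ []) cs) (every _ singles) bound z with y ≟ x
    ... | yes refl rewrite graft-x cs = begin
      δ r z + mult z (labelsOfs (mapLabelss f cs ++ C₂))
        ≡⟨ cong (δ r z +_) (≡.trans (cong (mult z) (labelsOfs-++ (mapLabelss f cs) C₂))
                                    (mult-++ z (labelsOfs (mapLabelss f cs)) (labelsOfs C₂))) ⟩
      δ r z + (mult z (labelsOfs (mapLabelss f cs)) + mult z (labelsOfs C₂))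
        ≡⟨ x∙yz≈y∙xz (δ r z) (mult z (labelsOfs (mapLabelss f cs))) (mult z (labelsOfs C₂)) ⟩
      mult z (labelsOfs (mapLabelss f cs)) + (δ r z + mult z (labelsOfs C₂))
        ≡⟨ cong₂ _+_ (≡.trans (cong (mult z) (labelsOfs-mapLabelss f cs))
                              (mult-map-φ f f-≤ f-> (labelsOfs cs) (x∉children (labelsOfs cs) bound) z))
                     (≡.trans (T₂-enum z) (sym (δ-x-φ z))) ⟩
      mult (φ z) (labelsOfs cs) + δ x (φ z)
        ≡⟨ +-comm _ (δ x (φ z)) ⟩
      δ x (φ z) + mult (φ z) (labelsOfs cs) ∎
      where open ≡.≡-Reasoning
    ... | no y≢x rewrite graft-≢ y cs y≢x =
      cong₂ _+_ (δ-f-φ f f-≤ f-> y z y≢x) (mult-graftCs cs singles (≤-trans (m≤n+m _ (δ y x)) bound) z)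

    mult-graftCs : ∀ cs → All (Every SingleLabel) cs → mult x (labelsOfs cs) ≤ 1 →
                   ∀ z → mult z (labelsOfs (goCs (mapLabelss f cs))) ≡ mult (φ z) (labelsOfs cs)
    mult-graftCs []       []                 _     z = refl
    mult-graftCs (c ∷ cs) (single ∷ singles) bound z = begin
      mult z (labelsOf (graft c) ++ labelsOfs (goCs (mapLabelss f cs)))
        ≡⟨ mult-++ z (labelsOf (graft c)) _ ⟩
      mult z (labelsOf (graft c)) + mult z (labelsOfs (goCs (mapLabelss f cs)))
        ≡⟨ cong₂ _+_ (mult-graft c single (≤-trans (m≤m+n _ _) bound') z)
                     (mult-graftCs cs singles (≤-trans (m≤n+m _ _) bound') z) ⟩
      mult (φ z) (labelsOf c) + mult (φ z) (labelsOfs cs)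
        ≡⟨ sym (mult-cons (φ z) c cs) ⟩
      mult (φ z) (labelsOfs (c ∷ cs)) ∎
      where
      open ≡.≡-Reasoning
      bound' = subst (_≤ 1) (mult-cons x c cs) bound

  IntervalLabels-graft : ∀ t → Every SingleLabel t → IntervalLabels t → IntervalLabels (graft t)
  IntervalLabels-graft t singles (a , b , 1≤a , enum) =
    lower a , upper b , ≤-trans 1≤a (lower-≥ a) ,
    λ z → ≡.trans (mult-graft t singles (Enumerates⇒mult≤1 {a} {b} (labelsOf t) x enum) z)
                  (≡.trans (enum (φ z)) (χ-φ a b z))

  mutual
    Every-IntervalLabels-graft : ∀ t → Every SingleLabel t → Every IntervalLabels t → Every IntervalLabels (graft t)
    Every-IntervalLabels-graft t@(node (y ∷ []) cs) singles@(every _ singles') (every interval intervals)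
      with y ≟ x
    ... | yes refl rewrite graft-x cs = every (subst IntervalLabels (graft-x cs) (IntervalLabels-graft t singles interval))
      (All.++⁺ (subst (All (Every IntervalLabels)) (mapLabelss-∌x cs x∉cs)
                      (All-Every-IntervalLabels-graft cs singles' intervals))
               C₂-interval)
      where
      x∉cs = let (a , b , _ , enum) = interval in
             x∉children (labelsOfs cs) (Enumerates⇒mult≤1 {a} {b} (labelsOf t) x enum)
    ... | no y≢x rewrite graft-≢ y cs y≢x =
      every (subst IntervalLabels (graft-≢ y cs y≢x) (IntervalLabels-graft t singles interval))
            (All-Every-IntervalLabels-graft cs singles' intervals)

    All-Every-IntervalLabels-graft : ∀ cs → All (Every SingleLabel) cs → All (Every IntervalLabels) cs →
                                     All (Every IntervalLabels) (goCs (mapLabelss f cs))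
    All-Every-IntervalLabels-graft []       []                 []                     = []
    All-Every-IntervalLabels-graft (c ∷ cs) (single ∷ singles) (interval ∷ intervals) =
      Every-IntervalLabels-graft c single interval ∷ All-Every-IntervalLabels-graft cs singles intervals

  mutual
    Every-SingleLabel-graft : ∀ t → Every SingleLabel t → Every SingleLabel (graft t)
    Every-SingleLabel-graft (node (y ∷ []) cs) (every _ singles) with y ≟ x
    ... | yes refl rewrite graft-x cs =
      every refl (All.++⁺ (All-Every-mapLabels f (λ {s} → SingleLabel-mapLabels f {s}) singles) C₂-single)
    ... | no y≢x rewrite graft-≢ y cs y≢x = every refl (All-Every-SingleLabel-graft cs singles)

    All-Every-SingleLabel-graft : ∀ cs → All (Every SingleLabel) cs → All (Every SingleLabel) (goCs (mapLabelss f cs))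
    All-Every-SingleLabel-graft []       []                 = []
    All-Every-SingleLabel-graft (c ∷ cs) (single ∷ singles) =
      Every-SingleLabel-graft c single ∷ All-Every-SingleLabel-graft cs singles

  WellLabelled-graft : ∀ {w} t → 1 ≤ x → x ≤ w → WellLabelled w t → WellLabelled (w + k) (graft t)
  WellLabelled-graft {w} t 1≤x x≤w (singles , intervals , enum) =
    Every-SingleLabel-graft t singles , Every-IntervalLabels-graft t singles intervals ,
    λ z → begin
      mult z (labelsOf (graft t))     ≡⟨ mult-graft t singles (Enumerates⇒mult≤1 {1} {w} (labelsOf t) x enum) z ⟩
      mult (φ z) (labelsOf t)          ≡⟨ enum (φ z) ⟩
      χ 1 w (φ z)                      ≡⟨ χ-φ 1 w z ⟩
      χ (lower 1) (upper w) z          ≡⟨ cong₂ (λ a b → χ a b z) (lower-≤x 1≤x) (upper-≥x x≤w) ⟩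
      χ 1 (w + k) z                    ∎
    where open ≡.≡-Reasoning

module Shift (c : ℕ) where

  δ-shift : ∀ y z → y ≢ 0 → δ (y + c) z ≡ δ y (z ∸ c)
  δ-shift y z y≢0 = δ-cong (λ y+c≡z → ≡.trans (sym (m+n∸n≡m y c)) (cong (_∸ c) y+c≡z)) from
    where
    from : y ≡ z ∸ c → y + c ≡ z
    from y≡z∸c with c ≤? z
    ... | yes c≤z = ≡.trans (cong (_+ c) y≡z∸c) (m∸n+n≡m c≤z)
    ... | no c≰z  = ⊥-elim (y≢0 (≡.trans y≡z∸c (m≤n⇒m∸n≡0 (<⇒≤ (≰⇒> c≰z)))))

  χ-shift : ∀ a b z → 1 ≤ a → χ a b (z ∸ c) ≡ χ (a + c) (b + c) z
  χ-shift a b z 1≤a = χ-cong to (m+n≤o⇒m≤o∸n a) (m∸n≤o⇒m≤o+n z c b) (m≤o+n⇒m∸n≤o z c b)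
    where
    to : a ≤ z ∸ c → a + c ≤ z
    to a≤z∸c with c ≤? z
    ... | yes c≤z = m≤o∸n⇒m+n≤o a c≤z a≤z∸c
    ... | no c≰z  = ⊥-elim (n≮0 (subst (1 ≤_) (m≤n⇒m∸n≡0 (<⇒≤ (≰⇒> c≰z))) (≤-trans 1≤a a≤z∸c)))

  Enumerates-shift : ∀ {a b} L → 1 ≤ a → Enumerates a b L → Enumerates (a + c) (b + c) (map (_+ c) L)
  Enumerates-shift {a} {b} L 1≤a enum z =
    ≡.trans (mult-map (_+ c) 0 z (z ∸ c) (λ y y≢0 → δ-shift y z y≢0) L (≡.trans (enum 0) (χ-below {a} {b} 1≤a)))
            (≡.trans (enum (z ∸ c)) (χ-shift a b z 1≤a))

  IntervalLabels-shift : ∀ {s} → IntervalLabels s → IntervalLabels (mapLabels (_+ c) s)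
  IntervalLabels-shift {s} (a , b , 1≤a , enum) =
    a + c , b + c , ≤-trans 1≤a (m≤m+n a c) ,
    subst (Enumerates (a + c) (b + c)) (sym (labelsOf-mapLabels (_+ c) s)) (Enumerates-shift (labelsOf s) 1≤a enum)

WellLabelled-∘ : ∀ {w m T₁ T₂} x → 1 ≤ x → x ≤ weight T₁ →
                 WellLabelled w T₁ → WellLabelled m T₂ → WellLabelled (w + m ∸ 1) (T₁ ∘⟨ x ⟩ T₂)
WellLabelled-∘ {T₂ = node []          _} _ _ _ _ (every () _ , _)
WellLabelled-∘ {T₂ = node (_ ∷ _ ∷ _) _} _ _ _ _ (every () _ , _)
WellLabelled-∘ {w} {m} {T₁} {T₂@(node (r ∷ []) C₂)} x 1≤x x≤wt wl₁
               (every _ singles₂ , every _ intervals₂ , enum₂) =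
  subst (λ n → WellLabelled n (T₁ ∘⟨ x ⟩ T₂)) w+k≡w+m∸1
    (Graft.WellLabelled-graft x k f f-≤ f-> (r + c) (mapLabelss (_+ c) C₂) T₂-enum singles₂' intervals₂'
                              T₁ 1≤x x≤w wl₁)
  where
  open ≡.≡-Reasoning
  k = length (labelsOfs C₂)
  c = x ∸ 1
  open Shift c

  f : ℕ → ℕ
  f y = if x <ᵇ y then y + suc k ∸ 1 else y

  f-≤ : ∀ y → y ≤ x → f y ≡ y
  f-≤ y y≤x = if-false (<ᵇ-false y≤x)

  f-> : ∀ y → x < y → f y ≡ y + k
  f-> y x<y = ≡.trans (if-true (<ᵇ-true x<y)) (cong (_∸ 1) (+-suc y k))

  m≡1+k : m ≡ suc k
  m≡1+k = sym (Enumerates⇒length (labelsOf T₂) enum₂)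

  w+k≡w+m∸1 : w + k ≡ w + m ∸ 1
  w+k≡w+m∸1 = ≡.trans (cong (_∸ 1) (sym (+-suc w k))) (cong (λ m → w + m ∸ 1) (sym m≡1+k))

  x≤w : x ≤ w
  x≤w = ≤-trans x≤wt (≤-reflexive (Enumerates⇒length (labelsOf T₁) (proj₂ (proj₂ wl₁))))

  1+c≡x : 1 + c ≡ x
  1+c≡x = m+[n∸m]≡n 1≤x

  m+c≡x+k : m + c ≡ x + k
  m+c≡x+k = begin
    m + c          ≡⟨ cong (_+ c) m≡1+k ⟩
    suc (k + c)    ≡⟨ cong suc (+-comm k c) ⟩
    suc (c + k)    ≡⟨ cong (_+ k) 1+c≡x ⟩
    x + k          ∎

  T₂-enum : Enumerates x (x + k) (labelsOf (mapLabels (_+ c) T₂))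
  T₂-enum z = begin
    mult z (labelsOf (mapLabels (_+ c) T₂))  ≡⟨ cong (mult z) (labelsOf-mapLabels (_+ c) T₂) ⟩
    mult z (map (_+ c) (labelsOf T₂))        ≡⟨ Enumerates-shift (labelsOf T₂) ≤-refl enum₂ z ⟩
    χ (1 + c) (m + c) z                      ≡⟨ cong₂ (λ a b → χ a b z) 1+c≡x m+c≡x+k ⟩
    χ x (x + k) z                            ∎

  singles₂' = All-Every-mapLabels (_+ c) (λ {s} → SingleLabel-mapLabels (_+ c) {s}) singles₂
  intervals₂' = All-Every-mapLabels (_+ c) (λ {s} → IntervalLabels-shift {s}) intervals₂

Enumerates-1 : Enumerates 1 1 (1 ∷ [])
Enumerates-1 zero          = refl
Enumerates-1 (suc zero)    = refl
Enumerates-1 (suc (suc _)) = refl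

Enumerates-2 : Enumerates 2 2 (2 ∷ [])
Enumerates-2 zero                = refl
Enumerates-2 (suc zero)          = refl
Enumerates-2 (suc (suc zero))    = refl
Enumerates-2 (suc (suc (suc _))) = refl

Enumerates-12 : Enumerates 1 2 (1 ∷ 2 ∷ [])
Enumerates-12 zero                = refl
Enumerates-12 (suc zero)          = refl
Enumerates-12 (suc (suc zero))    = refl
Enumerates-12 (suc (suc (suc _))) = refl

Enumerates-21 : Enumerates 1 2 (2 ∷ 1 ∷ [])
Enumerates-21 zero                = refl
Enumerates-21 (suc zero)          = refl
Enumerates-21 (suc (suc zero))    = refl
Enumerates-21 (suc (suc (suc _))) = refl

WellLabelled-unitTree : WellLabelled 1 unitTree
WellLabelled-unitTree = every refl [] , every (1 , 1 , ≤-refl , Enumerates-1) [] , Enumerates-1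

WellLabelled-genI : WellLabelled 2 genI
WellLabelled-genI =
  every refl (every refl [] ∷ []) ,
  every (1 , 2 , ≤-refl , Enumerates-12) (every (2 , 2 , s≤s z≤n , Enumerates-2) [] ∷ []) ,
  Enumerates-12

WellLabelled-genII : WellLabelled 2 genII
WellLabelled-genII =
  every refl (every refl [] ∷ []) ,
  every (1 , 2 , ≤-refl , Enumerates-21) (every (1 , 1 , ≤-refl , Enumerates-1) [] ∷ []) ,
  Enumerates-21

InBW⇒WellLabelled : ∀ {T} → InBW T → Σ ℕ λ n → WellLabelled n T
InBW⇒WellLabelled unit = 1 , WellLabelled-unitTree
InBW⇒WellLabelled gI   = 2 , WellLabelled-genI
InBW⇒WellLabelled gII  = 2 , WellLabelled-genII
InBW⇒WellLabelled (comp x 1≤x x≤wt T₁∈BW T₂∈BW) with InBW⇒WellLabelled T₁∈BW | InBW⇒WellLabelled T₂∈BW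
... | w , wl₁ | m , wl₂ = w + m ∸ 1 , WellLabelled-∘ x 1≤x x≤wt wl₁ wl₂
InBW⇒WellLabelled (iso T≈T' T∈BW) with InBW⇒WellLabelled T∈BW
... | n , wl = n , WellLabelled-≈ T≈T' wl

WellLabelled⇒conditions : ∀ {n T} → WellLabelled n T → RecursivelyLabelled T × NoEmptyNode T × AtMostOneLabel T
WellLabelled⇒conditions (singles , intervals , _) =
  Every-map (λ (a , b , _ , enum) → Enumerates⇒IsInterval {a} {b} _ enum) intervals ,
  Every-map (λ single → ≤-reflexive (sym single)) singles ,
  Every-map ≤-reflexive singles

-- Decomposition at a leaf

leaf : ℕ → Tree
leaf ℓ = node (ℓ ∷ []) []

data HasLeafChild (q ℓ : ℕ) : Tree → Set where
  leafChild : ∀ {cs} → leaf ℓ ∈ cs → HasLeafChild q ℓ (node (q ∷ []) cs)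
  inChild   : ∀ {ls cs} → Any (HasLeafChild q ℓ) cs → HasLeafChild q ℓ (node ls cs)

mult-leaf : ∀ ℓ → mult ℓ (labelsOf (leaf ℓ)) ≡ 1
mult-leaf ℓ = ≡.trans (+-identityʳ (δ ℓ ℓ)) (δ-refl ℓ)

Any⇒mult≥1 : ∀ {P : Tree → Set} z cs → Any P cs → (∀ {c} → P c → 1 ≤ mult z (labelsOf c)) → 1 ≤ mult z (labelsOfs cs)
Any⇒mult≥1 z (c ∷ cs) (here p) P⇒ rewrite mult-cons z c cs = ≤-trans (P⇒ p) (m≤m+n _ _)
Any⇒mult≥1 z (c ∷ cs) (there p) P⇒ rewrite mult-cons z c cs = ≤-trans (Any⇒mult≥1 z cs p P⇒) (m≤n+m _ _)

leaf∈⇒mult≥1 : ∀ ℓ cs → leaf ℓ ∈ cs → 1 ≤ mult ℓ (labelsOfs cs)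
leaf∈⇒mult≥1 ℓ cs ℓ∈ = Any⇒mult≥1 ℓ cs ℓ∈ (λ { refl → ≤-reflexive (sym (mult-leaf ℓ)) })

module _ {q ℓ : ℕ} where
  mutual
    HasLeafChild⇒mult≥1 : ∀ {z t} → z ≡ q ⊎ z ≡ ℓ → HasLeafChild q ℓ t → 1 ≤ mult z (labelsOf t)
    HasLeafChild⇒mult≥1 (inj₁ refl) (leafChild _) rewrite δ-refl q = s≤s z≤n
    HasLeafChild⇒mult≥1 (inj₂ refl) (leafChild {cs} ℓ∈) = ≤-trans (leaf∈⇒mult≥1 ℓ cs ℓ∈) (m≤n+m _ (δ q ℓ))
    HasLeafChild⇒mult≥1 {z} {node ls cs} z∈ (inChild p) rewrite mult-node z ls cs =
      ≤-trans (Any-HasLeafChild⇒mult≥1 z∈ p) (m≤n+m _ _)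

    Any-HasLeafChild⇒mult≥1 : ∀ {z cs} → z ≡ q ⊎ z ≡ ℓ → Any (HasLeafChild q ℓ) cs → 1 ≤ mult z (labelsOfs cs)
    Any-HasLeafChild⇒mult≥1 {z} {c ∷ cs} z∈ (here p) rewrite mult-cons z c cs =
      ≤-trans (HasLeafChild⇒mult≥1 z∈ p) (m≤m+n _ _)
    Any-HasLeafChild⇒mult≥1 {z} {c ∷ cs} z∈ (there p) rewrite mult-cons z c cs =
      ≤-trans (Any-HasLeafChild⇒mult≥1 z∈ p) (m≤n+m _ _)

  HasLeafChild⇒¬isSoleLeaf : ∀ {t} → HasLeafChild q ℓ t → isSoleLeaf ℓ t ≡ false
  HasLeafChild⇒¬isSoleLeaf (leafChild (here refl))  = refl
  HasLeafChild⇒¬isSoleLeaf (leafChild (there _))    = refl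
  HasLeafChild⇒¬isSoleLeaf {node [] (_ ∷ _)} (inChild _)           = refl
  HasLeafChild⇒¬isSoleLeaf {node (_ ∷ []) (_ ∷ _)} (inChild _)     = refl
  HasLeafChild⇒¬isSoleLeaf {node (_ ∷ _ ∷ _) (_ ∷ _)} (inChild _)  = refl

isSoleLeaf-∌ : ∀ ℓ c → mult ℓ (labelsOf c) ≡ 0 → isSoleLeaf ℓ c ≡ false
isSoleLeaf-∌ ℓ (node [] _)                _  = refl
isSoleLeaf-∌ ℓ (node (y ∷ []) [])         ℓ∉ = ≡ᵇ-false {y} {ℓ} (δ≡0⇒≢ (m+n≡0⇒m≡0 (δ y ℓ) ℓ∉))
isSoleLeaf-∌ ℓ (node (y ∷ []) (_ ∷ _))    _  = refl
isSoleLeaf-∌ ℓ (node (_ ∷ _ ∷ _) _)       _  = refl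

-- Deleting the leaf labelled ℓ and closing the gap in the labels; labels z of the result correspond to F z.
module RemoveLeaf (ℓ : ℕ) where

  h : ℕ → ℕ
  h y = if ℓ <ᵇ y then y ∸ 1 else y

  F : ℕ → ℕ
  F z = if ℓ ≤ᵇ z then suc z else z

  h-≤ : ∀ {y} → y ≤ ℓ → h y ≡ y
  h-≤ y≤ℓ = if-false (<ᵇ-false y≤ℓ)

  h-> : ∀ {y} → ℓ < y → h y ≡ y ∸ 1
  h-> ℓ<y = if-true (<ᵇ-true ℓ<y)

  F-< : ∀ {z} → z < ℓ → F z ≡ z
  F-< z<ℓ = if-false (≤ᵇ-false z<ℓ)

  F-≥ : ∀ {z} → ℓ ≤ z → F z ≡ suc z
  F-≥ ℓ≤z = if-true (≤ᵇ-true ℓ≤z)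

  F≢ℓ : ∀ z → F z ≢ ℓ
  F≢ℓ z Fz≡ℓ with z <? ℓ
  ... | yes z<ℓ rewrite F-< z<ℓ = <-irrefl Fz≡ℓ z<ℓ
  ... | no z≮ℓ  rewrite F-≥ (≮⇒≥ z≮ℓ) = <-irrefl (sym Fz≡ℓ) (s≤s (≮⇒≥ z≮ℓ))

  δ-h-F : ∀ y z → y ≢ ℓ → δ (h y) z ≡ δ y (F z)
  δ-h-F y z y≢ℓ = δ-cong to from
    where
    to : h y ≡ z → y ≡ F z
    to hy≡z with y <? ℓ
    ... | yes y<ℓ rewrite h-≤ (<⇒≤ y<ℓ) | hy≡z = sym (F-< y<ℓ)
    ... | no y≮ℓ = sym (≡.trans (F-≥ ℓ≤z) (≡.trans (cong suc (sym y∸1≡z)) (m+[n∸m]≡n (≤-trans (s≤s z≤n) ℓ<y))))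
      where
      ℓ<y = ≤∧≢⇒< (≮⇒≥ y≮ℓ) (λ ℓ≡y → y≢ℓ (sym ℓ≡y))
      y∸1≡z = ≡.trans (sym (h-> ℓ<y)) hy≡z
      ℓ≤z = subst (ℓ ≤_) y∸1≡z (<⇒≤pred ℓ<y)
    from : y ≡ F z → h y ≡ z
    from y≡Fz with z <? ℓ
    ... | yes z<ℓ rewrite F-< z<ℓ | y≡Fz = h-≤ (<⇒≤ z<ℓ)
    ... | no z≮ℓ  rewrite F-≥ (≮⇒≥ z≮ℓ) | y≡Fz = h-> (s≤s (≮⇒≥ z≮ℓ))

  mutual
    prune : Tree → Tree
    prune (node ls cs) = node (map h ls) (pruneCs cs)

    pruneCs : List Tree → List Tree
    pruneCs []       = []
    pruneCs (c ∷ cs) = if isSoleLeaf ℓ c then pruneCs cs else prune c ∷ pruneCs cs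

  pruneCs-keep : ∀ c cs → isSoleLeaf ℓ c ≡ false → pruneCs (c ∷ cs) ≡ prune c ∷ pruneCs cs
  pruneCs-keep c cs e = cong (λ t → if t then pruneCs cs else prune c ∷ pruneCs cs) e

  pruneCs-leaf : ∀ cs → pruneCs (leaf ℓ ∷ cs) ≡ pruneCs cs
  pruneCs-leaf cs = cong (λ t → if t then pruneCs cs else prune (leaf ℓ) ∷ pruneCs cs) (≡ᵇ-true {ℓ} refl)


  module _ (1≤ℓ : 1 ≤ ℓ) where

    lower : ℕ → ℕ
    lower a = if a ≤ᵇ ℓ then a else a ∸ 1

    upper : ℕ → ℕ
    upper b = if b <ᵇ ℓ then b else b ∸ 1

    lower-adjoint : ∀ a z → (a ≤ F z → lower a ≤ z) × (lower a ≤ z → a ≤ F z)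
    lower-adjoint a z with a ≤? ℓ | z <? ℓ
    ... | yes a≤ℓ | yes z<ℓ rewrite if-true {u = a} {v = a ∸ 1} (≤ᵇ-true a≤ℓ) | F-< z<ℓ = (λ p → p) , (λ p → p)
    ... | yes a≤ℓ | no z≮ℓ rewrite if-true {u = a} {v = a ∸ 1} (≤ᵇ-true a≤ℓ) | F-≥ (≮⇒≥ z≮ℓ) =
      (λ _ → ≤-trans a≤ℓ (≮⇒≥ z≮ℓ)) , m≤n⇒m≤1+n
    ... | no a≰ℓ | yes z<ℓ rewrite if-false {u = a} {v = a ∸ 1} (≤ᵇ-false (≰⇒> a≰ℓ)) | F-< z<ℓ =
      (λ a≤z → ⊥-elim (<⇒≱ (<-trans z<ℓ (≰⇒> a≰ℓ)) a≤z)) ,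
      (λ a∸1≤z → ⊥-elim (<⇒≱ z<ℓ (≤-trans (<⇒≤pred (≰⇒> a≰ℓ)) a∸1≤z)))
    ... | no a≰ℓ | no z≮ℓ rewrite if-false {u = a} {v = a ∸ 1} (≤ᵇ-false (≰⇒> a≰ℓ)) | F-≥ (≮⇒≥ z≮ℓ) =
      (λ a≤1+z → pred-mono-≤ a≤1+z) , (λ a∸1≤z → ≤-trans (m∸n≤o⇒m≤o+n a 1 z a∸1≤z) (≤-reflexive (+-comm z 1)))

    upper-adjoint : ∀ b z → (F z ≤ b → z ≤ upper b) × (z ≤ upper b → F z ≤ b)
    upper-adjoint b z with b <? ℓ | z <? ℓ
    ... | yes b<ℓ | yes z<ℓ rewrite if-true {u = b} {v = b ∸ 1} (<ᵇ-true b<ℓ) | F-< z<ℓ = (λ p → p) , (λ p → p)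
    ... | yes b<ℓ | no z≮ℓ rewrite if-true {u = b} {v = b ∸ 1} (<ᵇ-true b<ℓ) | F-≥ (≮⇒≥ z≮ℓ) =
      (λ 1+z≤b → ⊥-elim (<⇒≱ b<ℓ (≤-trans (≮⇒≥ z≮ℓ) (<⇒≤ 1+z≤b)))) ,
      (λ z≤b → ⊥-elim (<⇒≱ b<ℓ (≤-trans (≮⇒≥ z≮ℓ) z≤b)))
    ... | no b≮ℓ | yes z<ℓ rewrite if-false {u = b} {v = b ∸ 1} (<ᵇ-false (≮⇒≥ b≮ℓ)) | F-< z<ℓ =
      (λ _ → <⇒≤pred (≤-trans z<ℓ (≮⇒≥ b≮ℓ))) ,
      (λ _ → ≤-trans (<⇒≤ z<ℓ) (≮⇒≥ b≮ℓ))
    ... | no b≮ℓ | no z≮ℓ rewrite if-false {u = b} {v = b ∸ 1} (<ᵇ-false (≮⇒≥ b≮ℓ)) | F-≥ (≮⇒≥ z≮ℓ) =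
      <⇒≤pred ,
      (λ z≤b∸1 → ≤-trans (≤-reflexive (+-comm 1 z)) (m≤o∸n⇒m+n≤o z (≤-trans 1≤ℓ (≮⇒≥ b≮ℓ)) z≤b∸1))

    χ-F : ∀ a b z → χ a b (F z) ≡ χ (lower a) (upper b) z
    χ-F a b z = χ-cong (proj₁ (lower-adjoint a z)) (proj₂ (lower-adjoint a z))
                       (proj₁ (upper-adjoint b z)) (proj₂ (upper-adjoint b z))

    1≤lower : ∀ {a} → 1 ≤ a → 1 ≤ lower a
    1≤lower {a} 1≤a with a ≤? ℓ
    ... | yes a≤ℓ rewrite if-true {u = a} {v = a ∸ 1} (≤ᵇ-true a≤ℓ) = 1≤a
    ... | no a≰ℓ rewrite if-false {u = a} {v = a ∸ 1} (≤ᵇ-false (≰⇒> a≰ℓ)) =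
      <⇒≤pred (≤-trans (s≤s 1≤ℓ) (≰⇒> a≰ℓ))

    lower-1 : lower 1 ≡ 1
    lower-1 = if-true (≤ᵇ-true 1≤ℓ)

    upper-suc : ∀ {m} → ℓ ≤ suc m → upper (suc m) ≡ m
    upper-suc ℓ≤1+m = if-false (<ᵇ-false ℓ≤1+m)

    Pruned : Tree → Tree → Set
    Pruned t t' = Every SingleLabel t' × Every IntervalLabels t' × (∀ z → mult z (labelsOf t') ≡ mult (F z) (labelsOf t))

    Pruneds : List Tree → List Tree → Set
    Pruneds cs cs' = All (Every SingleLabel) cs' × All (Every IntervalLabels) cs' ×
                     (∀ z → mult z (labelsOfs cs') ≡ mult (F z) (labelsOfs cs))

    Pruned-node : ∀ ls cs cs' → Every SingleLabel (node ls cs) → Every IntervalLabels (node ls cs) →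
                  mult ℓ ls ≡ 0 → Pruneds cs cs' → Pruned (node ls cs) (node (map h ls) cs')
    Pruned-node ls cs cs' (every single _) (every (a , b , 1≤a , enum) _) ℓ∉ls (singles' , intervals' , mult≡) =
      every (≡.trans (length-map h ls) single) singles' ,
      every (lower a , upper b , 1≤lower 1≤a , λ z → ≡.trans (mult≡' z) (≡.trans (enum (F z)) (χ-F a b z))) intervals' ,
      mult≡'
      where
      mult≡' : ∀ z → mult z (map h ls ++ labelsOfs cs') ≡ mult (F z) (ls ++ labelsOfs cs)
      mult≡' z = ≡.trans (mult-++ z (map h ls) (labelsOfs cs'))
        (≡.trans (cong₂ _+_ (mult-map h ℓ z (F z) (λ y y≢ℓ → δ-h-F y z y≢ℓ) ls ℓ∉ls) (mult≡ z))
                 (sym (mult-++ (F z) ls (labelsOfs cs))))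

    Pruneds-∷ : ∀ {c c' cs cs'} → Pruned c c' → Pruneds cs cs' → Pruneds (c ∷ cs) (c' ∷ cs')
    Pruneds-∷ {c} {c'} {cs} {cs'} (single , interval , mult≡) (singles , intervals , mults≡) =
      single ∷ singles , interval ∷ intervals ,
      λ z → ≡.trans (mult-cons z c' cs') (≡.trans (cong₂ _+_ (mult≡ z) (mults≡ z)) (sym (mult-cons (F z) c cs)))

    mutual
      prune-∌ℓ : ∀ t → Every SingleLabel t → Every IntervalLabels t → mult ℓ (labelsOf t) ≡ 0 → Pruned t (prune t)
      prune-∌ℓ (node ls cs) singles@(every _ singles') intervals@(every _ intervals') ℓ∉ =
        let (ℓ∉ls , ℓ∉cs) = mult-node≡0 ℓ ls cs ℓ∉ in
        Pruned-node ls cs (pruneCs cs) singles intervals ℓ∉ls (pruneCs-∌ℓ cs singles' intervals' ℓ∉cs)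

      pruneCs-∌ℓ : ∀ cs → All (Every SingleLabel) cs → All (Every IntervalLabels) cs → mult ℓ (labelsOfs cs) ≡ 0 →
                   Pruneds cs (pruneCs cs)
      pruneCs-∌ℓ []       _                  _                      _  = [] , [] , λ _ → refl
      pruneCs-∌ℓ (c ∷ cs) (single ∷ singles) (interval ∷ intervals) ℓ∉ =
        let (ℓ∉c , ℓ∉cs) = mult-cons≡0 ℓ c cs ℓ∉ in
        subst (Pruneds (c ∷ cs)) (sym (pruneCs-keep c cs (isSoleLeaf-∌ ℓ c ℓ∉c)))
              (Pruneds-∷ {c} {prune c} {cs} {pruneCs cs} (prune-∌ℓ c single interval ℓ∉c)
                                                         (pruneCs-∌ℓ cs singles intervals ℓ∉cs))

    pruneCs-∋leaf : ∀ cs → leaf ℓ ∈ cs → All (Every SingleLabel) cs → All (Every IntervalLabels) cs →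
                    mult ℓ (labelsOfs cs) ≤ 1 → Pruneds cs (pruneCs cs)
    pruneCs-∋leaf (_ ∷ cs) (here refl) (_ ∷ singles) (_ ∷ intervals) bound rewrite pruneCs-leaf cs =
      let (singles' , intervals' , mults≡) =
            pruneCs-∌ℓ cs singles intervals (1≤m⇒m+n≤1⇒n≡0 (≤-reflexive (sym (mult-leaf ℓ)))
                                                           (subst (_≤ 1) (mult-cons ℓ (leaf ℓ) cs) bound)) in
      singles' , intervals' ,
      λ z → ≡.trans (mults≡ z) (sym (cong (_+ mult (F z) (labelsOfs cs)) (δ-≢ (≢-sym (F≢ℓ z)))))
    pruneCs-∋leaf (c ∷ cs) (there ℓ∈) (single ∷ singles) (interval ∷ intervals) bound =
      let bound' = subst (_≤ 1) (mult-cons ℓ c cs) bound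
          ℓ∉c = 1≤n⇒m+n≤1⇒m≡0 (leaf∈⇒mult≥1 ℓ cs ℓ∈) bound' in
      subst (Pruneds (c ∷ cs)) (sym (pruneCs-keep c cs (isSoleLeaf-∌ ℓ c ℓ∉c)))
        (Pruneds-∷ {c} {prune c} {cs} {pruneCs cs} (prune-∌ℓ c single interval ℓ∉c)
                   (pruneCs-∋leaf cs ℓ∈ singles intervals (≤-trans (m≤n+m _ _) bound')))

    module _ {q : ℕ} (q≢ℓ : q ≢ ℓ) where
      mutual
        prune-HasLeafChild : ∀ t → HasLeafChild q ℓ t → Every SingleLabel t → Every IntervalLabels t →
                             mult ℓ (labelsOf t) ≤ 1 → Pruned t (prune t)
        prune-HasLeafChild (node ls cs) (leafChild ℓ∈) singles@(every _ singles') intervals@(every _ intervals') bound =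
          Pruned-node ls cs (pruneCs cs) singles intervals (cong (_+ 0) (δ-≢ q≢ℓ))
            (pruneCs-∋leaf cs ℓ∈ singles' intervals' (≤-trans (m≤n+m _ (δ q ℓ)) bound))
        prune-HasLeafChild (node ls cs) (inChild p) singles@(every _ singles') intervals@(every _ intervals') bound =
          let bound' = subst (_≤ 1) (mult-node ℓ ls cs) bound in
          Pruned-node ls cs (pruneCs cs) singles intervals (1≤n⇒m+n≤1⇒m≡0 (Any-HasLeafChild⇒mult≥1 (inj₂ refl) p) bound')
            (pruneCs-HasLeafChild cs p singles' intervals' (≤-trans (m≤n+m _ _) bound'))

        pruneCs-HasLeafChild : ∀ cs → Any (HasLeafChild q ℓ) cs → All (Every SingleLabel) cs →
                               All (Every IntervalLabels) cs → mult ℓ (labelsOfs cs) ≤ 1 → Pruneds cs (pruneCs cs)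
        pruneCs-HasLeafChild (c ∷ cs) (here p) (single ∷ singles) (interval ∷ intervals) bound
          rewrite pruneCs-keep c cs (HasLeafChild⇒¬isSoleLeaf p) =
          let bound' = subst (_≤ 1) (mult-cons ℓ c cs) bound in
          Pruneds-∷ {c} {prune c} {cs} {pruneCs cs} (prune-HasLeafChild c p single interval (≤-trans (m≤m+n _ _) bound'))
            (pruneCs-∌ℓ cs singles intervals (1≤m⇒m+n≤1⇒n≡0 (HasLeafChild⇒mult≥1 (inj₂ refl) p) bound'))
        pruneCs-HasLeafChild (c ∷ cs) (there p) (single ∷ singles) (interval ∷ intervals) bound =
          let bound' = subst (_≤ 1) (mult-cons ℓ c cs) bound
              ℓ∉c = 1≤n⇒m+n≤1⇒m≡0 (Any-HasLeafChild⇒mult≥1 (inj₂ refl) p) bound' in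
          subst (Pruneds (c ∷ cs)) (sym (pruneCs-keep c cs (isSoleLeaf-∌ ℓ c ℓ∉c)))
            (Pruneds-∷ {c} {prune c} {cs} {pruneCs cs} (prune-∌ℓ c single interval ℓ∉c)
                       (pruneCs-HasLeafChild cs p singles intervals (≤-trans (m≤n+m _ _) bound')))

      WellLabelled-prune : ∀ {m t} → HasLeafChild q ℓ t → WellLabelled (suc m) t → WellLabelled m (prune t)
      WellLabelled-prune {m} {t} p (singles , intervals , enum) =
        let (singles' , intervals' , mult≡) =
              prune-HasLeafChild t p singles intervals (Enumerates⇒mult≤1 {1} {suc m} (labelsOf t) ℓ enum)
            ℓ≤1+m = proj₂ (χ≥1⇒inside {1} {suc m} (≤-trans (HasLeafChild⇒mult≥1 (inj₂ refl) p) (≤-reflexive (enum ℓ)))) in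
        singles' , intervals' ,
        λ z → ≡.trans (mult≡ z) (≡.trans (enum (F z))
                (≡.trans (χ-F 1 (suc m) z) (cong₂ (λ a b → χ a b z) lower-1 (upper-suc ℓ≤1+m))))


-- Grafting the generator back at x undoes the pruning, up to the order of children.
module Regraft (ℓ : ℕ) (q : ℕ) (q≢ℓ : q ≢ ℓ) (x : ℕ) (f : ℕ → ℕ)
  (f∘h≗id : ∀ y → y ≢ q → y ≢ ℓ → f (RemoveLeaf.h ℓ y) ≡ y)
  (f∘h-q : f (RemoveLeaf.h ℓ q) ≡ x) (x≡q⊎ℓ : x ≡ q ⊎ x ≡ ℓ) where

  open RemoveLeaf ℓ
  open InsertAt x q (leaf ℓ ∷ [])

  map-f∘h : ∀ ls → mult q ls ≡ 0 → mult ℓ ls ≡ 0 → map f (map h ls) ≡ ls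
  map-f∘h []       _   _   = refl
  map-f∘h (y ∷ ls) q∉ ℓ∉ =
    cong₂ _∷_ (f∘h≗id y (δ≡0⇒≢ (m+n≡0⇒m≡0 (δ y q) q∉)) (δ≡0⇒≢ (m+n≡0⇒m≡0 (δ y ℓ) ℓ∉)))
              (map-f∘h ls (m+n≡0⇒n≡0 (δ y q) q∉) (m+n≡0⇒n≡0 (δ y ℓ) ℓ∉))

  mutual
    relabel-prune-∌ : ∀ t → mult q (labelsOf t) ≡ 0 → mult ℓ (labelsOf t) ≡ 0 → mapLabels f (prune t) ≡ t
    relabel-prune-∌ (node ls cs) q∉ ℓ∉ =
      let (q∉ls , q∉cs) = mult-node≡0 q ls cs q∉
          (ℓ∉ls , ℓ∉cs) = mult-node≡0 ℓ ls cs ℓ∉ in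
      cong₂ node (map-f∘h ls q∉ls ℓ∉ls) (relabel-pruneCs-∌ cs q∉cs ℓ∉cs)

    relabel-pruneCs-∌ : ∀ cs → mult q (labelsOfs cs) ≡ 0 → mult ℓ (labelsOfs cs) ≡ 0 → mapLabelss f (pruneCs cs) ≡ cs
    relabel-pruneCs-∌ []       _  _  = refl
    relabel-pruneCs-∌ (c ∷ cs) q∉ ℓ∉ =
      let (q∉c , q∉cs) = mult-cons≡0 q c cs q∉
          (ℓ∉c , ℓ∉cs) = mult-cons≡0 ℓ c cs ℓ∉ in
      ≡.trans (cong (mapLabelss f) (pruneCs-keep c cs (isSoleLeaf-∌ ℓ c ℓ∉c)))
              (cong₂ _∷_ (relabel-prune-∌ c q∉c ℓ∉c) (relabel-pruneCs-∌ cs q∉cs ℓ∉cs))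

  x∉ : ∀ L → mult q L ≡ 0 → mult ℓ L ≡ 0 → mult x L ≡ 0
  x∉ L q∉ ℓ∉ = [ (λ x≡q → subst (λ v → mult v L ≡ 0) (sym x≡q) q∉)
               , (λ x≡ℓ → subst (λ v → mult v L ≡ 0) (sym x≡ℓ) ℓ∉) ]′ x≡q⊎ℓ

  regraft-∌ : ∀ t → mult q (labelsOf t) ≡ 0 → mult ℓ (labelsOf t) ≡ 0 → go (mapLabels f (prune t)) ≡ t
  regraft-∌ t q∉ ℓ∉ = ≡.trans (cong go (relabel-prune-∌ t q∉ ℓ∉)) (go-∌x t (x∉ (labelsOf t) q∉ ℓ∉))

  regraftCs-∌ : ∀ cs → mult q (labelsOfs cs) ≡ 0 → mult ℓ (labelsOfs cs) ≡ 0 → goCs (mapLabelss f (pruneCs cs)) ≡ cs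
  regraftCs-∌ cs q∉ ℓ∉ = ≡.trans (cong goCs (relabel-pruneCs-∌ cs q∉ ℓ∉)) (goCs-∌x cs (x∉ (labelsOfs cs) q∉ ℓ∉))

  regraftCs-∋leaf : ∀ cs → leaf ℓ ∈ cs → mult q (labelsOfs cs) ≡ 0 → mult ℓ (labelsOfs cs) ≤ 1 →
                    (mapLabelss f (pruneCs cs) ++ leaf ℓ ∷ []) ≈ₗ cs
  regraftCs-∋leaf (_ ∷ cs) (here refl) q∉ bound rewrite pruneCs-leaf cs =
    let ℓ∉cs = 1≤m⇒m+n≤1⇒n≡0 (≤-reflexive (sym (mult-leaf ℓ))) (subst (_≤ 1) (mult-cons ℓ (leaf ℓ) cs) bound) in
    subst (λ ts → (ts ++ leaf ℓ ∷ []) ≈ₗ (leaf ℓ ∷ cs))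
          (sym (relabel-pruneCs-∌ cs (proj₂ (mult-cons≡0 q (leaf ℓ) cs q∉)) ℓ∉cs))
          (≈ₗ-rotate (leaf ℓ) cs)
  regraftCs-∋leaf (c ∷ cs) (there ℓ∈) q∉ bound =
    let bound' = subst (_≤ 1) (mult-cons ℓ c cs) bound
        ℓ∉c = 1≤n⇒m+n≤1⇒m≡0 (leaf∈⇒mult≥1 ℓ cs ℓ∈) bound'
        (q∉c , q∉cs) = mult-cons≡0 q c cs q∉ in
    subst (_≈ₗ (c ∷ cs))
      (sym (≡.trans (cong (λ ts → mapLabelss f ts ++ leaf ℓ ∷ []) (pruneCs-keep c cs (isSoleLeaf-∌ ℓ c ℓ∉c)))
                    (cong (λ t → t ∷ (mapLabelss f (pruneCs cs) ++ leaf ℓ ∷ [])) (relabel-prune-∌ c q∉c ℓ∉c))))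
      (cons ≈-refl (regraftCs-∋leaf cs ℓ∈ q∉cs (≤-trans (m≤n+m _ _) bound')))

  mutual
    regraft-HasLeafChild : ∀ t → HasLeafChild q ℓ t → mult q (labelsOf t) ≤ 1 → mult ℓ (labelsOf t) ≤ 1 →
                           go (mapLabels f (prune t)) ≈ t
    regraft-HasLeafChild (node _ cs) (leafChild ℓ∈) q-bound ℓ-bound =
      subst (_≈ node (q ∷ []) cs)
        (sym (≡.trans (cong (λ y → go (node (y ∷ []) (mapLabelss f (pruneCs cs)))) f∘h-q) (go-x _)))
        (node≈ refl (regraftCs-∋leaf cs ℓ∈ (1≤m⇒m+n≤1⇒n≡0 (≤-reflexive (sym (δ-refl q))) q-bound)
                                           (≤-trans (m≤n+m _ (δ q ℓ)) ℓ-bound)))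
    regraft-HasLeafChild (node ls cs) (inChild p) q-bound ℓ-bound =
      let q-bound' = subst (_≤ 1) (mult-node q ls cs) q-bound
          ℓ-bound' = subst (_≤ 1) (mult-node ℓ ls cs) ℓ-bound
          q∉ls = 1≤n⇒m+n≤1⇒m≡0 (Any-HasLeafChild⇒mult≥1 (inj₁ refl) p) q-bound'
          ℓ∉ls = 1≤n⇒m+n≤1⇒m≡0 (Any-HasLeafChild⇒mult≥1 (inj₂ refl) p) ℓ-bound' in
      subst (_≈ node ls cs)
        (sym (≡.trans (cong (λ ls' → go (node ls' (mapLabelss f (pruneCs cs)))) (map-f∘h ls q∉ls ℓ∉ls))
                      (go-∌ ls _ (elem-false x ls (x∉ ls q∉ls ℓ∉ls)))))
        (node≈ refl (regraftCs-HasLeafChild cs p (≤-trans (m≤n+m _ _) q-bound') (≤-trans (m≤n+m _ _) ℓ-bound')))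

    regraftCs-HasLeafChild : ∀ cs → Any (HasLeafChild q ℓ) cs → mult q (labelsOfs cs) ≤ 1 → mult ℓ (labelsOfs cs) ≤ 1 →
                             goCs (mapLabelss f (pruneCs cs)) ≈ₗ cs
    regraftCs-HasLeafChild (c ∷ cs) (here p) q-bound ℓ-bound rewrite pruneCs-keep c cs (HasLeafChild⇒¬isSoleLeaf p) =
      let q-bound' = subst (_≤ 1) (mult-cons q c cs) q-bound
          ℓ-bound' = subst (_≤ 1) (mult-cons ℓ c cs) ℓ-bound in
      cons (regraft-HasLeafChild c p (≤-trans (m≤m+n _ _) q-bound') (≤-trans (m≤m+n _ _) ℓ-bound'))
           (subst (_≈ₗ cs) (sym (regraftCs-∌ cs (1≤m⇒m+n≤1⇒n≡0 (HasLeafChild⇒mult≥1 (inj₁ refl) p) q-bound')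
                                                (1≤m⇒m+n≤1⇒n≡0 (HasLeafChild⇒mult≥1 (inj₂ refl) p) ℓ-bound')))
                  ≈ₗ-refl)
    regraftCs-HasLeafChild (c ∷ cs) (there p) q-bound ℓ-bound =
      let q-bound' = subst (_≤ 1) (mult-cons q c cs) q-bound
          ℓ-bound' = subst (_≤ 1) (mult-cons ℓ c cs) ℓ-bound
          q∉c = 1≤n⇒m+n≤1⇒m≡0 (Any-HasLeafChild⇒mult≥1 (inj₁ refl) p) q-bound'
          ℓ∉c = 1≤n⇒m+n≤1⇒m≡0 (Any-HasLeafChild⇒mult≥1 (inj₂ refl) p) ℓ-bound' in
      subst (_≈ₗ (c ∷ cs)) (sym (cong (λ ts → goCs (mapLabelss f ts)) (pruneCs-keep c cs (isSoleLeaf-∌ ℓ c ℓ∉c))))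
        (cons (subst (_≈ c) (sym (regraft-∌ c q∉c ℓ∉c)) ≈-refl)
              (regraftCs-HasLeafChild cs p (≤-trans (m≤n+m _ _) q-bound') (≤-trans (m≤n+m _ _) ℓ-bound')))

Adjacent : ℕ → ℕ → Set
Adjacent q ℓ = ℓ ≡ suc q ⊎ suc ℓ ≡ q

AllLeaves : List Tree → Set
AllLeaves = All (λ c → Σ ℕ λ y → c ≡ leaf y)

AdjacentLeaf : Tree → Set
AdjacentLeaf t = Σ ℕ λ q → Σ ℕ λ ℓ → Adjacent q ℓ × HasLeafChild q ℓ t

AnyAdjacentLeaf : List Tree → Set
AnyAdjacentLeaf cs = Σ ℕ λ q → Σ ℕ λ ℓ → Adjacent q ℓ × Any (HasLeafChild q ℓ) cs

leaf∈ : ∀ y cs → AllLeaves cs → 1 ≤ mult y (labelsOfs cs) → leaf y ∈ cs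
leaf∈ y (_ ∷ cs) ((y' , refl) ∷ leaves) y∈ with y' ≟ y
... | yes refl  = here refl
... | no y'≢y rewrite δ-≢ y'≢y = there (leaf∈ y cs leaves y∈)

-- If all children of the node q₀ are leaves, the interval spanned by the node contains q₀ + 1
-- (if q₀ is not its maximum) or q₀ − 1 (lying between a child and q₀), necessarily as a leaf.
leaves-adjacent : ∀ {a b} q₀ c cs → AllLeaves (c ∷ cs) → Enumerates a b (q₀ ∷ labelsOfs (c ∷ cs)) →
                  Σ ℕ λ ℓ → Adjacent q₀ ℓ × leaf ℓ ∈ (c ∷ cs)
leaves-adjacent {a} {b} q₀ c cs leaves@((y , refl) ∷ _) enum = choose (q₀ <? b)
  where
  L = labelsOfs (c ∷ cs)

  inside : ∀ z → 1 ≤ mult z L → a ≤ z × z ≤ b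
  inside z z∈ = χ≥1⇒inside (≤-trans (≤-trans z∈ (m≤n+m _ (δ q₀ z))) (≤-reflexive (enum z)))

  q₀-inside : a ≤ q₀ × q₀ ≤ b
  q₀-inside = χ≥1⇒inside (≤-trans (≤-trans (≤-reflexive (sym (δ-refl q₀))) (m≤m+n _ _)) (≤-reflexive (enum q₀)))

  q₀∉L : mult q₀ L ≡ 0
  q₀∉L = 1≤m⇒m+n≤1⇒n≡0 (≤-reflexive (sym (δ-refl q₀))) (Enumerates⇒mult≤1 {a} {b} (q₀ ∷ L) q₀ enum)

  child : ∀ z → z ≢ q₀ → a ≤ z → z ≤ b → leaf z ∈ (c ∷ cs)
  child z z≢q₀ a≤z z≤b = leaf∈ z (c ∷ cs) leaves (≤-reflexive (sym (begin
    mult z L                ≡⟨ cong (_+ mult z L) (sym (δ-≢ (λ q₀≡z → z≢q₀ (sym q₀≡z)))) ⟩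
    δ q₀ z + mult z L       ≡⟨ enum z ⟩
    χ a b z                 ≡⟨ χ-inside a≤z z≤b ⟩
    1                       ∎)))
    where open ≡.≡-Reasoning

  y∈L : 1 ≤ mult y L
  y∈L = ≤-trans (≤-reflexive (sym (δ-refl y))) (m≤m+n _ _)

  y<q₀ : b ≤ q₀ → y < q₀
  y<q₀ b≤q₀ = ≤∧≢⇒< (≤-trans (proj₂ (inside y y∈L)) b≤q₀)
                    (λ y≡q₀ → n≮0 (subst (1 ≤_) (subst (λ v → mult v L ≡ 0) (sym y≡q₀) q₀∉L) y∈L))

  choose : Dec (q₀ < b) → Σ ℕ λ ℓ → Adjacent q₀ ℓ × leaf ℓ ∈ (c ∷ cs)
  choose (yes q₀<b) = suc q₀ , inj₁ refl ,
    child (suc q₀) 1+n≢n (≤-trans (proj₁ q₀-inside) (n≤1+n q₀)) q₀<b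
  choose (no q₀≮b) = q₀ ∸ 1 , inj₂ 1+[q₀∸1]≡q₀ ,
    child (q₀ ∸ 1) (λ q₀∸1≡q₀ → <-irrefl q₀∸1≡q₀ (≤-reflexive 1+[q₀∸1]≡q₀))
          (≤-trans (proj₁ (inside y y∈L)) (<⇒≤pred (y<q₀ (≮⇒≥ q₀≮b))))
          (≤-trans (m∸n≤m q₀ 1) (proj₂ q₀-inside))
    where
    1+[q₀∸1]≡q₀ : suc (q₀ ∸ 1) ≡ q₀
    1+[q₀∸1]≡q₀ = m+[n∸m]≡n (≤-trans (s≤s z≤n) (y<q₀ (≮⇒≥ q₀≮b)))

mutual
  adjacentLeaf : ∀ q₀ c cs → Every SingleLabel (node (q₀ ∷ []) (c ∷ cs)) → Every IntervalLabels (node (q₀ ∷ []) (c ∷ cs)) →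
                 AdjacentLeaf (node (q₀ ∷ []) (c ∷ cs))
  adjacentLeaf q₀ c cs (every _ singles) (every (a , b , _ , enum) intervals) with adjacentLeafCs (c ∷ cs) singles intervals
  ... | inj₁ (q , ℓ , adj , p) = q , ℓ , adj , inChild p
  ... | inj₂ leaves = let (ℓ , adj , ℓ∈) = leaves-adjacent {a} {b} q₀ c cs leaves enum in q₀ , ℓ , adj , leafChild ℓ∈

  adjacentLeafCs : ∀ cs → All (Every SingleLabel) cs → All (Every IntervalLabels) cs → AnyAdjacentLeaf cs ⊎ AllLeaves cs
  adjacentLeafCs [] _ _ = inj₂ []
  adjacentLeafCs (node []          _ ∷ _) (every () _ ∷ _) _
  adjacentLeafCs (node (_ ∷ _ ∷ _) _ ∷ _) (every () _ ∷ _) _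
  adjacentLeafCs (node (q₀ ∷ []) (d ∷ ds) ∷ cs) (single ∷ _) (interval ∷ _) =
    let (q , ℓ , adj , p) = adjacentLeaf q₀ d ds single interval in inj₁ (q , ℓ , adj , here p)
  adjacentLeafCs (node (y ∷ []) [] ∷ cs) (_ ∷ singles) (_ ∷ intervals) with adjacentLeafCs cs singles intervals
  ... | inj₁ (q , ℓ , adj , p) = inj₁ (q , ℓ , adj , there p)
  ... | inj₂ leaves            = inj₂ ((y , refl) ∷ leaves)

module _ {T : Tree} where

  prune-∘-genI : ∀ {q} → 1 ≤ q → HasLeafChild q (suc q) T → mult q (labelsOf T) ≤ 1 → mult (suc q) (labelsOf T) ≤ 1 →
                 (RemoveLeaf.prune (suc q) T ∘⟨ q ⟩ genI) ≈ T
  prune-∘-genI {q} 1≤q p q-bound ℓ-bound =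
    subst (_≈ T) (cong (λ T₂ → Insert.go q T₂ (mapLabels f (prune T))) (sym genI-shifted))
      (Regraft.regraft-HasLeafChild (suc q) q (≢-sym 1+n≢n) q f f∘h≗id f∘h-q (inj₁ refl) T p q-bound ℓ-bound)
    where
    open RemoveLeaf (suc q) using (h; h-≤; h->; prune)
    f : ℕ → ℕ
    f y = if q <ᵇ y then y + 2 ∸ 1 else y
    f∘h≗id : ∀ y → y ≢ q → y ≢ suc q → f (h y) ≡ y
    f∘h≗id y y≢q y≢1+q with y <? suc q
    ... | yes y<1+q rewrite h-≤ (<⇒≤ y<1+q) = if-false (<ᵇ-false (s≤s⁻¹ y<1+q))
    ... | no y≮1+q  = f∘h-above (≤∧≢⇒< (≮⇒≥ y≮1+q) (λ 1+q≡y → y≢1+q (sym 1+q≡y)))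
      where
      f∘h-above : suc q < y → f (h y) ≡ y
      f∘h-above 1+q<y rewrite h-> 1+q<y =
        ≡.trans (if-true (<ᵇ-true (<⇒≤pred 1+q<y)))
                (≡.trans (m+2∸1≡1+m (y ∸ 1)) (1+[m∸1]≡m (≤-trans (s≤s z≤n) 1+q<y)))
    f∘h-q : f (h q) ≡ q
    f∘h-q rewrite h-≤ (n≤1+n q) = if-false (<ᵇ-false {q} ≤-refl)
    genI-shifted : mapLabels (_+ (q ∸ 1)) genI ≡ node (q ∷ []) (leaf (suc q) ∷ [])
    genI-shifted = cong (λ u → node (u ∷ []) (leaf (suc u) ∷ [])) (1+[m∸1]≡m 1≤q)

  prune-∘-genII : ∀ {ℓ} → 1 ≤ ℓ → HasLeafChild (suc ℓ) ℓ T → mult (suc ℓ) (labelsOf T) ≤ 1 → mult ℓ (labelsOf T) ≤ 1 →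
                  (RemoveLeaf.prune ℓ T ∘⟨ ℓ ⟩ genII) ≈ T
  prune-∘-genII {ℓ} 1≤ℓ p q-bound ℓ-bound =
    subst (_≈ T) (cong (λ T₂ → Insert.go ℓ T₂ (mapLabels f (prune T))) (sym genII-shifted))
      (Regraft.regraft-HasLeafChild ℓ (suc ℓ) 1+n≢n ℓ f f∘h≗id f∘h-q (inj₂ refl) T p q-bound ℓ-bound)
    where
    open RemoveLeaf ℓ using (h; h-≤; h->; prune)
    f : ℕ → ℕ
    f y = if ℓ <ᵇ y then y + 2 ∸ 1 else y
    f∘h≗id : ∀ y → y ≢ suc ℓ → y ≢ ℓ → f (h y) ≡ y
    f∘h≗id y y≢1+ℓ y≢ℓ with y ≤? ℓ
    ... | yes y≤ℓ rewrite h-≤ y≤ℓ = if-false (<ᵇ-false y≤ℓ)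
    ... | no y≰ℓ  = f∘h-above (≰⇒> y≰ℓ) (≤∧≢⇒< (≰⇒> y≰ℓ) (λ 1+ℓ≡y → y≢1+ℓ (sym 1+ℓ≡y)))
      where
      f∘h-above : ℓ < y → suc ℓ < y → f (h y) ≡ y
      f∘h-above ℓ<y 1+ℓ<y rewrite h-> ℓ<y =
        ≡.trans (if-true (<ᵇ-true (<⇒≤pred 1+ℓ<y)))
                (≡.trans (m+2∸1≡1+m (y ∸ 1)) (1+[m∸1]≡m (≤-trans (s≤s z≤n) 1+ℓ<y)))
    f∘h-q : f (h (suc ℓ)) ≡ ℓ
    f∘h-q rewrite h-> {suc ℓ} ≤-refl = if-false (<ᵇ-false {ℓ} ≤-refl)
    genII-shifted : mapLabels (_+ (ℓ ∸ 1)) genII ≡ node (suc ℓ ∷ []) (leaf ℓ ∷ [])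
    genII-shifted = cong (λ u → node (suc u ∷ []) (leaf u ∷ [])) (1+[m∸1]≡m 1≤ℓ)


module _ {m T q ℓ} (p : HasLeafChild q ℓ T) (wl : WellLabelled (suc m) T) where

  leafChild-inside : ∀ {z} → z ≡ q ⊎ z ≡ ℓ → 1 ≤ z × z ≤ suc m
  leafChild-inside {z} z∈ = χ≥1⇒inside {1} {suc m} (≤-trans (HasLeafChild⇒mult≥1 z∈ p) (≤-reflexive (proj₂ (proj₂ wl) z)))

  leafChild-mult≤1 : ∀ z → mult z (labelsOf T) ≤ 1
  leafChild-mult≤1 z = Enumerates⇒mult≤1 {1} {suc m} (labelsOf T) z (proj₂ (proj₂ wl))

  WellLabelled-pruneLeaf : q ≢ ℓ → WellLabelled m (RemoveLeaf.prune ℓ T)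
  WellLabelled-pruneLeaf q≢ℓ = RemoveLeaf.WellLabelled-prune ℓ (proj₁ (leafChild-inside (inj₂ refl))) q≢ℓ p wl

  weight-pruneLeaf : q ≢ ℓ → weight (RemoveLeaf.prune ℓ T) ≡ m
  weight-pruneLeaf q≢ℓ = Enumerates⇒length (labelsOf (RemoveLeaf.prune ℓ T)) (proj₂ (proj₂ (WellLabelled-pruneLeaf q≢ℓ)))

AdjacentLeaf⇒InBW : ∀ {m T q ℓ} → Adjacent q ℓ → HasLeafChild q ℓ T → WellLabelled (suc m) T →
                    (∀ {T'} → WellLabelled m T' → InBW T') → InBW T
AdjacentLeaf⇒InBW {q = q} (inj₁ refl) p wl IH =
  iso (prune-∘-genI 1≤q p (leafChild-mult≤1 p wl q) (leafChild-mult≤1 p wl (suc q)))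
      (comp q 1≤q (≤-trans (s≤s⁻¹ (proj₂ (leafChild-inside p wl (inj₂ refl))))
                           (≤-reflexive (sym (weight-pruneLeaf p wl (≢-sym 1+n≢n)))))
            (IH (WellLabelled-pruneLeaf p wl (≢-sym 1+n≢n))) gI)
  where 1≤q = proj₁ (leafChild-inside p wl (inj₁ refl))
AdjacentLeaf⇒InBW {ℓ = ℓ} (inj₂ refl) p wl IH =
  iso (prune-∘-genII 1≤ℓ p (leafChild-mult≤1 p wl (suc ℓ)) (leafChild-mult≤1 p wl ℓ))
      (comp ℓ 1≤ℓ (≤-trans (s≤s⁻¹ (proj₂ (leafChild-inside p wl (inj₁ refl))))
                           (≤-reflexive (sym (weight-pruneLeaf p wl 1+n≢n))))
            (IH (WellLabelled-pruneLeaf p wl 1+n≢n)) gII)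
  where 1≤ℓ = proj₁ (leafChild-inside p wl (inj₂ refl))

WellLabelled⇒InBW : ∀ m T → WellLabelled m T → InBW T
WellLabelled⇒InBW _ (node []          _) (every () _ , _)
WellLabelled⇒InBW _ (node (_ ∷ _ ∷ _) _) (every () _ , _)
WellLabelled⇒InBW zero (node (y ∷ []) cs) (_ , _ , enum) with () ← Enumerates⇒length (labelsOf (node (y ∷ []) cs)) enum
WellLabelled⇒InBW (suc m) (node (y ∷ []) []) (_ , _ , enum) with Enumerates⇒length (y ∷ []) enum
... | refl with χ≥1⇒inside {1} {1} {y} (≤-trans (≤-reflexive (sym (mult-leaf y))) (≤-reflexive (enum y)))
... | 1≤y , y≤1 with ≤-antisym y≤1 1≤y
... | refl = unit
WellLabelled⇒InBW (suc m) (node (q₀ ∷ []) (c ∷ cs)) wl@(singles , intervals , _) =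
  let (q , ℓ , adj , p) = adjacentLeaf q₀ c cs singles intervals in
  AdjacentLeaf⇒InBW adj p wl (WellLabelled⇒InBW m _)

conditions⇒WellLabelled : ∀ n T → IsRWTree n T → RecursivelyLabelled T → NoEmptyNode T → AtMostOneLabel T →
                          WellLabelled n T
conditions⇒WellLabelled n T (unique , range , _) intervals nonEmpty atMostOne =
  Every-zipWith (λ 1≤len len≤1 → ≤-antisym len≤1 1≤len) nonEmpty atMostOne ,
  Every-zipWith (λ {s} → intervalLabels {s}) intervals (Every-mult≤ (χ 1 n) T (λ z → ≤-reflexive (enum z))) ,
  enum
  where
  enum : Enumerates 1 n (labelsOf T)
  enum = IsInterval⇒Enumerates (labelsOf T) (Unique⇒mult≤1 (labelsOf T) unique) range
  intervalLabels : ∀ {s} → IsInterval (labelsOf s) → (∀ z → mult z (labelsOf s) ≤ χ 1 n z) → IntervalLabels s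
  intervalLabels {s} (a , b , iff) bound =
    a , b , 1≤a a iff , IsInterval⇒Enumerates (labelsOf s) (λ z → ≤-trans (bound z) (χ≤1 1 n z)) iff
    where
    1≤a : ∀ a → (∀ y → (y ∈ labelsOf s) ⇔ (a ≤ y × y ≤ b)) → 1 ≤ a
    1≤a (suc _) _   = s≤s z≤n
    1≤a zero    iff = ⊥-elim (n≮0 (≤-trans (∈⇒mult≥1 (Equivalence.from (iff 0) (z≤n , z≤n))) (bound 0)))

mainTheorem11 : ∀ (n : ℕ) (T : Tree) → IsRWTree n T →
    InBW T ⇔ (RecursivelyLabelled T × NoEmptyNode T × AtMostOneLabel T)
mainTheorem11 n T rwTree = mk⇔
  (λ T∈BW → WellLabelled⇒conditions (proj₂ (InBW⇒WellLabelled T∈BW)))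
  (λ (recursive , nonEmpty , atMostOne) →
     WellLabelled⇒InBW n T (conditions⇒WellLabelled n T rwTree recursive nonEmpty atMostOne))
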